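{- For every positive integer $n$ and every nontrivial divisible abelian linearly ordered group $D$, the cyclically ordered group $T(\mathbb{U})_n\overrightarrow{\times}D$ is weakly cyclically minimal.
   Context: A cyclically ordered group is a group with a ternary relation $R$ that is strict, cyclic ($R(a,b,c)\Rightarrow R(b,c,a)$), such that each $R(g,\cdot,\cdot)$ is a strict linear order on $G\setminus\{g\}$, and compatible with the group operation. $T(\mathbb{U})_n$ is the group of complex $n$-th roots of unity with the cyclic order induced from the unit circle. For a cyclically ordered group $(H,R)$ and a linearly ordered group $\Lambda$, $H\overrightarrow{\times}\Lambda$ is $H\times\Lambda$ with $R'((g_1,x_1),(g_2,x_2),(g_3,x_3))$ iff either $g_1=g_2=g_3$ and $x_{\sigma(1)}<x_{\sigma(2)}<x_{\sigma(3)}$ for some cyclic permutation $\sigma$ of $\{1,2,3\}$, or $g_{\sigma(1)}=g_{\sigma(2)}\neq g_{\sigma(3)}$ and $x_{\sigma(1)}<x_{\sigma(2)}$ for some cyclic permutation $\sigma$, or $R(g_1,g_2,g_3)$. For $g\ne g'$, $I(g,g')=\{h:R(g,h,g')\}$; a subset $J$ is c-convex if it is a singleton or for all $g\neq g'$ in $J$, $I(g,g')\subseteq J$ or $I(g',g)\subseteq J$. An infinite cyclically ordered group is weakly cyclically minimal if every subset definable with parameters in $\{\cdot,R,e,{}^{ -1}\}$ is a finite union of c-convex subsets. -}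

module Defs where

open import Data.Nat as ℕ using (ℕ; zero; suc; NonZero; >-nonZero⁻¹)
open import Data.Nat.DivMod using (_%_; m%n<n)
open import Data.Fin as Fin using (Fin; toℕ; fromℕ<)
open import Data.Product using (Σ; ∃; _×_; _,_)
open import Data.Sum using (_⊎_)
open import Data.Empty using (⊥)
open import Data.List using (List)
open import Data.List.Relation.Unary.All using (All)
open import Data.List.Relation.Unary.Any using (Any)
open import Relation.Nullary using (¬_)
open import Relation.Binary.PropositionalEquality using (_≡_; _≢_)
open import Relation.Binary.Structures using (IsStrictTotalOrder)
open import Algebra.Structures using (IsGroup; IsAbelianGroup)
open import Function using (Surjective)
open import Function.Bundles using (_⇔_)

record CStr : Set₁ where
  field
    Carrier : Set
    _∙_     : Carrier → Carrier → Carrier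
    e       : Carrier
    _⁻¹     : Carrier → Carrier
    R       : Carrier → Carrier → Carrier → Set

Cyc3 : {A : Set} → (A → A → A → Set) → A → A → A → Set
Cyc3 P a b c = P a b c ⊎ P b c a ⊎ P c a b

module _ (M : CStr) where
  open CStr M
  private C = Carrier

  record IsCOGroup : Set where
    field
      isGroup : IsGroup _≡_ _∙_ e _⁻¹
      strict  : ∀ {a b c} → R a b c → a ≢ b × b ≢ c × c ≢ a
      cyclic  : ∀ {a b c} → R a b c → R b c a
      -- each R(g,·,·) is a strict linear order on G ∖ {g}
      irrefl  : ∀ g x → ¬ R g x x
      asym    : ∀ g x y → R g x y → ¬ R g y x
      trans   : ∀ g x y z → R g x y → R g y z → R g x z
      total   : ∀ g x y → x ≢ g → y ≢ g → x ≢ y → R g x y ⊎ R g y x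
      compatˡ : ∀ h a b c → R a b c → R (h ∙ a) (h ∙ b) (h ∙ c)
      compatʳ : ∀ h a b c → R a b c → R (a ∙ h) (b ∙ h) (c ∙ h)

  Infinite : Set
  Infinite = ∀ (k : ℕ) (f : Fin k → C) → ¬ Surjective _≡_ _≡_ f

  I : C → C → C → Set
  I g g' h = R g h g'

  IsCConvex : (C → Set) → Set
  IsCConvex J =
    (Σ C λ g → ∀ h → J h ⇔ (h ≡ g))
    ⊎ (∀ g g' → J g → J g' → g ≢ g' →
         (∀ h → I g g' h → J h) ⊎ (∀ h → I g' g h → J h))

  -- first-order terms and formulas with k free variables (de Bruijn)
  -- and arbitrary parameters from the carrier
  data Term (k : ℕ) : Set where
    var  : Fin k → Term k
    par  : C → Term k
    eₜ   : Term k
    _·ₜ_ : Term k → Term k → Term k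
    invₜ : Term k → Term k

  data Formula : ℕ → Set where
    _≐_  : ∀ {k} → Term k → Term k → Formula k
    Rₜ   : ∀ {k} → Term k → Term k → Term k → Formula k
    ⊥ₜ   : ∀ {k} → Formula k
    ¬ₜ_  : ∀ {k} → Formula k → Formula k
    _∧ₜ_ : ∀ {k} → Formula k → Formula k → Formula k
    _∨ₜ_ : ∀ {k} → Formula k → Formula k → Formula k
    _⇒ₜ_ : ∀ {k} → Formula k → Formula k → Formula k
    ∃ₜ   : ∀ {k} → Formula (suc k) → Formula k
    ∀ₜ   : ∀ {k} → Formula (suc k) → Formula k

  extend : ∀ {k} → C → (Fin k → C) → Fin (suc k) → C
  extend x ρ Fin.zero    = x
  extend x ρ (Fin.suc i) = ρ i

  evalT : ∀ {k} → (Fin k → C) → Term k → C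
  evalT ρ (var i)  = ρ i
  evalT ρ (par c)  = c
  evalT ρ eₜ       = e
  evalT ρ (s ·ₜ t) = evalT ρ s ∙ evalT ρ t
  evalT ρ (invₜ t) = evalT ρ t ⁻¹

  Sat : ∀ {k} → (Fin k → C) → Formula k → Set
  Sat ρ (s ≐ t)     = evalT ρ s ≡ evalT ρ t
  Sat ρ (Rₜ s t u)  = R (evalT ρ s) (evalT ρ t) (evalT ρ u)
  Sat ρ ⊥ₜ          = ⊥
  Sat ρ (¬ₜ φ)      = ¬ Sat ρ φ
  Sat ρ (φ ∧ₜ ψ)    = Sat ρ φ × Sat ρ ψ
  Sat ρ (φ ∨ₜ ψ)    = Sat ρ φ ⊎ Sat ρ ψ
  Sat ρ (φ ⇒ₜ ψ)    = Sat ρ φ → Sat ρ ψ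
  Sat ρ (∃ₜ φ)      = Σ C λ x → Sat (extend x ρ) φ
  Sat ρ (∀ₜ φ)      = ∀ x → Sat (extend x ρ) φ

  Defined : Formula 1 → C → Set
  Defined φ x = Sat (λ _ → x) φ

  DefinableFiniteCConvex : Set₁
  DefinableFiniteCConvex =
    ∀ (φ : Formula 1) →
      Σ (List (C → Set)) λ Js →
        All IsCConvex Js × (∀ x → Defined φ x ⇔ Any (λ J → J x) Js)

  WeaklyCyclicallyMinimal : Set₁
  WeaklyCyclicallyMinimal = IsCOGroup × Infinite × DefinableFiniteCConvex

record LinOrdAbGroup : Set₁ where
  field
    Carrier : Set
    _+_     : Carrier → Carrier → Carrier
    0#      : Carrier
    -_      : Carrier → Carrier
    _<_     : Carrier → Carrier → Set
    isAbelianGroup      : IsAbelianGroup _≡_ _+_ 0# -_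
    isStrictTotalOrder  : IsStrictTotalOrder _≡_ _<_
    +-mono-<            : ∀ {x y} z → x < y → (x + z) < (y + z)

  _×ℕ_ : ℕ → Carrier → Carrier
  zero  ×ℕ x = 0#
  suc m ×ℕ x = x + (m ×ℕ x)

  Divisible : Set
  Divisible = ∀ (m : ℕ) → m ≢ 0 → ∀ x → Σ Carrier λ y → (m ×ℕ y) ≡ x

  Nontrivial : Set
  Nontrivial = Σ Carrier λ x → x ≢ 0#

-- T(U)_n : the n-th roots of unity, ζ^k ↦ k ∈ Fin n, with
-- multiplication = addition mod n and the cyclic order induced by the
-- counterclockwise order of the unit circle (ζ = e^{2πi/n}).

module _ (n : ℕ) .{{_ : NonZero n}} where
  modn : ℕ → Fin n
  modn a = fromℕ< (m%n<n a n)

  TU : CStr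
  TU = record
    { Carrier = Fin n
    ; _∙_     = λ a b → modn (toℕ a ℕ.+ toℕ b)
    ; e       = modn 0
    ; _⁻¹     = λ a → modn (n ℕ.∸ toℕ a)
    ; R       = Cyc3 (λ a b c → (a Fin.< b) × (b Fin.< c))
    }

-- H ×→ Λ  (lexicographic product of a cyclically ordered group by a
-- linearly ordered group)

_×→_ : CStr → LinOrdAbGroup → CStr
H ×→ Λ = record
  { Carrier = H.Carrier × Λ.Carrier
  ; _∙_     = λ { (g , x) (h , y) → (g H.∙ h , x Λ.+ y) }
  ; e       = (H.e , Λ.0#)
  ; _⁻¹     = λ { (g , x) → (g H.⁻¹ , Λ.- x) }
  ; R       = R'
  }
  where
    module H = CStr H
    module Λ = LinOrdAbGroup Λ
    C' = H.Carrier × Λ.Carrier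
    R' : C' → C' → C' → Set
    R' (g₁ , x₁) (g₂ , x₂) (g₃ , x₃) =
        (g₁ ≡ g₂ × g₂ ≡ g₃ × Cyc3 (λ a b c → (a Λ.< b) × (b Λ.< c)) x₁ x₂ x₃)
      ⊎ Cyc3 (λ { (ga , xa) (gb , xb) (gc , xc) →
                  ga ≡ gb × gb ≢ gc × xa Λ.< xb })
             (g₁ , x₁) (g₂ , x₂) (g₃ , x₃)
      ⊎ H.R g₁ g₂ g₃

-- The order of T(U)ₙ ×→ D is the cyclic order induced by the lexicographic order on
-- Fin n × D, and it is compatible with the group operation because adding 1 in T(U)ₙ
-- rotates the circle. For minimality, fix the T(U)ₙ-components of all variables: terms
-- become linear forms over D, atomic formulas become Boolean combinations of linear
-- constraints, and a quantifier over the product becomes a disjunction over the n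
-- possible components of a quantifier over D. Nontrivial divisible ordered abelian
-- groups eliminate quantifiers (solve an equation for the variable, or else apply
-- Fourier–Motzkin), so over each g ∈ T(U)ₙ a definable set is a finite union of sets
-- {g} × C with C cut out by one-variable constraints. Such a C is convex in D, and
-- {g} × C is then c-convex.

{-# OPTIONS --safe #-}
module Submission where

open import Defs
open import Data.Nat as ℕ using (ℕ; zero; suc; NonZero; >-nonZero⁻¹)
import Data.Nat.Properties as ℕP
open import Data.Nat.DivMod using (_%_; m%n<n; %-distribˡ-+; m%n%n≡m%n; m<n⇒m%n≡m; n%n≡0)
open import Data.Fin as Fin using (Fin; toℕ)
import Data.Fin.Properties as FP
open import Data.Empty using (⊥; ⊥-elim)
open import Data.Unit using (⊤; tt)
open import Data.Product using (∃; _×_; _,_; proj₁; proj₂; uncurry)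
open import Data.Product.Function.NonDependent.Propositional using (_×-⇔_)
open import Data.Product.Relation.Binary.Lex.Strict using (×-Lex; ×-transitive; ×-compare)
open import Data.Product.Relation.Binary.Pointwise.NonDependent using (Pointwise; ≡×≡⇒≡; ≡⇒≡×≡)
open import Data.Sum as Sum using (_⊎_; inj₁; inj₂; [_,_]′)
open import Data.Sum.Function.Propositional using (_⊎-⇔_)
open import Data.List using (List; []; _∷_; _++_; map; concatMap; cartesianProductWith; allFin)
import Data.List.Extrema as Extrema
open import Data.List.Membership.Propositional using (_∈_; lose)
open import Data.List.Membership.Propositional.Properties using (∈-cartesianProductWith⁺; ∈-allFin)
open import Data.List.Relation.Unary.All as All using (All; []; _∷_)
import Data.List.Relation.Unary.All.Properties as Allₚ
open import Data.List.Relation.Unary.Any as Any using (Any; here; there)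
import Data.List.Relation.Unary.Any.Properties as Anyₚ
open import Data.Vec.Functional using (Vector; head; tail) renaming (_∷_ to _∷ᵥ_; [] to []ᵥ)
open import Function using (_∘_; id)
open import Function.Bundles using (_⇔_; mk⇔; Equivalence)
import Function.Properties.Equivalence as ⇔
open import Function.Related.Propositional using (module EquationalReasoning; equivalence)
open import Function.Related.TypeIsomorphisms using (¬-cong-⇔; →-cong-⇔)
open import Relation.Nullary using (¬_; Dec; yes; no)
import Relation.Nullary.Decidable as Dec
open import Relation.Nullary.Decidable using (_×-dec_; _⊎-dec_; ¬?; decidable-stable)
open import Relation.Binary.PropositionalEquality
open import Relation.Binary.Definitions using (Tri; tri<; tri≈; tri>)
open import Relation.Binary.Structures using (IsStrictTotalOrder)
open import Relation.Binary.Structures.Biased using (isStrictTotalOrderᶜ)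
open import Relation.Binary.Bundles using (TotalOrder)
import Relation.Binary.Construct.StrictToNonStrict as StrictToNonStrict
open import Algebra.Bundles using (AbelianGroup)
open import Algebra.Structures using (IsGroup; IsAbelianGroup)
open import Algebra.Consequences.Propositional using (comm∧idˡ⇒id; comm∧invʳ⇒inv)
import Algebra.Properties.AbelianGroup as AbelianGroupProperties
import Algebra.Properties.CommutativeSemigroup as CommutativeSemigroupProperties
import Algebra.Properties.CommutativeMonoid.Mult as MultProperties
Cyc3-rotate : {A : Set} {P : A → A → A → Set} {a b c : A} → Cyc3 P a b c → Cyc3 P b c a
Cyc3-rotate (inj₁ p)        = inj₂ (inj₂ p)
Cyc3-rotate (inj₂ (inj₁ p)) = inj₁ p
Cyc3-rotate (inj₂ (inj₂ p)) = inj₂ (inj₁ p)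

Cyc3-map : {A B : Set} {P : A → A → A → Set} {Q : B → B → B → Set} (f : A → B) →
           (∀ {a b c} → P a b c → Q (f a) (f b) (f c)) →
           ∀ {a b c} → Cyc3 P a b c → Cyc3 Q (f a) (f b) (f c)
Cyc3-map f h (inj₁ p)        = inj₁ (h p)
Cyc3-map f h (inj₂ (inj₁ p)) = inj₂ (inj₁ (h p))
Cyc3-map f h (inj₂ (inj₂ p)) = inj₂ (inj₂ (h p))

Between : {A : Set} → (A → A → Set) → A → A → A → Set
Between _<_ a b c = a < b × b < c

module CyclicClosure {A : Set} {_<_ : A → A → Set} (sto : IsStrictTotalOrder _≡_ _<_) where
  open IsStrictTotalOrder sto using (compare; irrefl; asym; _<?_) renaming (trans to <-trans)

  Cyclic : A → A → A → Set
  Cyclic = Cyc3 (Between _<_)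

  cyc-rotate : ∀ {a b c} → Cyclic a b c → Cyclic b c a
  cyc-rotate = Cyc3-rotate {P = Between _<_}

  private
    <⇒≢ : ∀ {x y} → x < y → x ≢ y
    <⇒≢ x<y refl = irrefl refl x<y

    >⇒≢ : ∀ {x y} → y < x → x ≢ y
    >⇒≢ y<x refl = irrefl refl y<x

  strict : ∀ {a b c} → Cyclic a b c → a ≢ b × b ≢ c × c ≢ a
  strict (inj₁ (ab , bc))        = <⇒≢ ab , <⇒≢ bc , >⇒≢ (<-trans ab bc)
  strict (inj₂ (inj₁ (bc , ca))) = >⇒≢ (<-trans bc ca) , <⇒≢ bc , <⇒≢ ca
  strict (inj₂ (inj₂ (ca , ab))) = <⇒≢ ab , >⇒≢ (<-trans ca ab) , <⇒≢ ca

  cyc-irrefl : ∀ g x → ¬ Cyclic g x x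
  cyc-irrefl g x (inj₁ (_ , xx))        = irrefl refl xx
  cyc-irrefl g x (inj₂ (inj₁ (xx , _))) = irrefl refl xx
  cyc-irrefl g x (inj₂ (inj₂ (xg , gx))) = asym xg gx

  cyc-asym : ∀ g x y → Cyclic g x y → ¬ Cyclic g y x
  cyc-asym g x y (inj₁ (p , q)) (inj₁ (p' , q'))                 = asym q q'
  cyc-asym g x y (inj₁ (p , q)) (inj₂ (inj₁ (p' , q')))          = asym q p'
  cyc-asym g x y (inj₁ (p , q)) (inj₂ (inj₂ (p' , q')))          = asym p p'
  cyc-asym g x y (inj₂ (inj₁ (p , q))) (inj₁ (p' , q'))          = asym q p'
  cyc-asym g x y (inj₂ (inj₁ (p , q))) (inj₂ (inj₁ (p' , q')))   = asym p p'
  cyc-asym g x y (inj₂ (inj₁ (p , q))) (inj₂ (inj₂ (p' , q')))   = asym q q'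
  cyc-asym g x y (inj₂ (inj₂ (p , q))) (inj₁ (p' , q'))          = asym p p'
  cyc-asym g x y (inj₂ (inj₂ (p , q))) (inj₂ (inj₁ (p' , q')))   = asym q q'
  cyc-asym g x y (inj₂ (inj₂ (p , q))) (inj₂ (inj₂ (p' , q')))   = asym p q'

  cyc-trans : ∀ g x y z → Cyclic g x y → Cyclic g y z → Cyclic g x z
  cyc-trans g x y z (inj₁ (p , q)) (inj₁ (p' , q'))               = inj₁ (p , <-trans q q')
  cyc-trans g x y z (inj₁ (p , q)) (inj₂ (inj₁ (p' , q')))        =
    ⊥-elim (asym (<-trans p q) (<-trans p' q'))
  cyc-trans g x y z (inj₁ (p , q)) (inj₂ (inj₂ (p' , q')))        = inj₂ (inj₂ (p' , p))
  cyc-trans g x y z (inj₂ (inj₁ (p , q))) (inj₁ (p' , q'))        = ⊥-elim (asym q p')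
  cyc-trans g x y z (inj₂ (inj₁ (p , q))) (inj₂ (inj₁ (p' , q'))) = inj₂ (inj₁ (<-trans p p' , q'))
  cyc-trans g x y z (inj₂ (inj₁ (p , q))) (inj₂ (inj₂ (p' , q'))) = ⊥-elim (asym q q')
  cyc-trans g x y z (inj₂ (inj₂ (p , q))) (inj₁ (p' , q'))        = ⊥-elim (asym p p')
  cyc-trans g x y z (inj₂ (inj₂ (p , q))) (inj₂ (inj₁ (p' , q'))) = inj₂ (inj₂ (q' , q))
  cyc-trans g x y z (inj₂ (inj₂ (p , q))) (inj₂ (inj₂ (p' , q'))) = ⊥-elim (asym p q')

  cyc-total : ∀ g x y → x ≢ g → y ≢ g → x ≢ y → Cyclic g x y ⊎ Cyclic g y x
  cyc-total g x y x≢g y≢g x≢y with compare g x | compare g y | compare x y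
  ... | tri≈ _ e _ | _ | _ = ⊥-elim (x≢g (sym e))
  ... | _ | tri≈ _ e _ | _ = ⊥-elim (y≢g (sym e))
  ... | _ | _ | tri≈ _ e _ = ⊥-elim (x≢y e)
  ... | tri< gx _ _ | tri< gy _ _ | tri< xy _ _ = inj₁ (inj₁ (gx , xy))
  ... | tri< gx _ _ | tri< gy _ _ | tri> _ _ yx = inj₂ (inj₁ (gy , yx))
  ... | tri< gx _ _ | tri> _ _ yg | tri< xy _ _ = ⊥-elim (asym (<-trans gx xy) yg)
  ... | tri< gx _ _ | tri> _ _ yg | tri> _ _ yx = inj₁ (inj₂ (inj₂ (yg , gx)))
  ... | tri> _ _ xg | tri< gy _ _ | tri< xy _ _ = inj₂ (inj₂ (inj₂ (xg , gy)))
  ... | tri> _ _ xg | tri< gy _ _ | tri> _ _ yx = ⊥-elim (asym (<-trans gy yx) xg)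
  ... | tri> _ _ xg | tri> _ _ yg | tri< xy _ _ = inj₁ (inj₂ (inj₁ (xy , yg)))
  ... | tri> _ _ xg | tri> _ _ yg | tri> _ _ yx = inj₂ (inj₂ (inj₁ (yx , xg)))

  cyclic? : ∀ a b c → Dec (Cyclic a b c)
  cyclic? a b c =
    ((a <? b) ×-dec (b <? c)) ⊎-dec (((b <? c) ×-dec (c <? a)) ⊎-dec ((c <? a) ×-dec (a <? b)))

module OrderedGroupProperties (D : LinOrdAbGroup) where
  open LinOrdAbGroup D public
    renaming (Carrier to Dc; _+_ to infixl 6 _+_; -_ to infix 8 -_; _<_ to infix 4 _<_)
    hiding (_×ℕ_)
  open IsStrictTotalOrder isStrictTotalOrder public
    using (compare) renaming (trans to <-trans; irrefl to <-irreflexive; asym to <-asym)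

  abelianGroup : AbelianGroup _ _
  abelianGroup = record { isAbelianGroup = isAbelianGroup }

  open AbelianGroup abelianGroup public
    using (_-_; comm; assoc; identityˡ; identityʳ; inverseˡ; inverseʳ)
  open AbelianGroupProperties abelianGroup public
    using (⁻¹-involutive; ε⁻¹≈ε; ⁻¹-∙-comm; inverseʳ-unique; x∙y⁻¹≈ε⇒x≈y; x≈y⇒x∙y⁻¹≈ε; ∙-cancelʳ)
  open CommutativeSemigroupProperties (AbelianGroup.commutativeSemigroup abelianGroup) public
    using (interchange)
  open MultProperties (AbelianGroup.commutativeMonoid abelianGroup) public
    using (×-homo-+; ×-assocˡ; ×-distrib-+) renaming (_×_ to infixr 8 _·_)

  -‿distrib-+ : ∀ x y → - (x + y) ≡ - x + - y
  -‿distrib-+ x y = sym (⁻¹-∙-comm x y)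

  +-cancel-middle : ∀ u v w → (u + v) + (w - u) ≡ v + w
  +-cancel-middle u v w = begin
    (u + v) + (w - u)  ≡⟨ cong₂ _+_ (comm u v) (comm w (- u)) ⟩
    (v + u) + (- u + w) ≡⟨ interchange v u (- u) w ⟩
    (v + - u) + (u + w) ≡⟨ cong (_+ (u + w)) (comm v (- u)) ⟩
    (- u + v) + (u + w) ≡⟨ interchange (- u) v u w ⟩
    (- u + u) + (v + w) ≡⟨ cong (_+ (v + w)) (inverseˡ u) ⟩
    0# + (v + w)        ≡⟨ identityˡ (v + w) ⟩
    v + w               ∎
    where open ≡-Reasoning

  -‿zero : ∀ {x} → x ≡ 0# → - x ≡ 0#
  -‿zero refl = ε⁻¹≈ε

  -‿zero⁻¹ : ∀ {x} → - x ≡ 0# → x ≡ 0#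
  -‿zero⁻¹ {x} p = trans (sym (⁻¹-involutive x)) (-‿zero p)

  <-irrefl : ∀ {x} → ¬ x < x
  <-irrefl = <-irreflexive refl

  <⇒≢ : ∀ {x y} → x < y → x ≢ y
  <⇒≢ x<y refl = <-irrefl x<y

  +-monoʳ-< : ∀ {x y} z → x < y → x + z < y + z
  +-monoʳ-< = +-mono-<

  +-monoˡ-< : ∀ {x y} z → x < y → z + x < z + y
  +-monoˡ-< {x} {y} z p = subst₂ _<_ (comm x z) (comm y z) (+-monoʳ-< z p)

  +-cancelʳ-< : ∀ {x y} z → x + z < y + z → x < y
  +-cancelʳ-< {x} {y} z p with compare x y
  ... | tri< x<y _ _  = x<y
  ... | tri≈ _ refl _ = ⊥-elim (<-irrefl p)
  ... | tri> _ _ y<x  = ⊥-elim (<-asym p (+-monoʳ-< z y<x))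

  x<x+y : ∀ x {y} → 0# < y → x < x + y
  x<x+y x {y} p = subst (_< x + y) (identityʳ x) (+-monoˡ-< x p)

  x-y<x : ∀ x {y} → 0# < y → x - y < x
  x-y<x x {y} p = subst (x - y <_) eq (x<x+y (x - y) p)
    where
    eq : x - y + y ≡ x
    eq = trans (assoc x (- y) y) (trans (cong (x +_) (inverseˡ y)) (identityʳ x))

  +-pos : ∀ {x y} → 0# < x → 0# < y → 0# < x + y
  +-pos {x} {y} p q = <-trans p (x<x+y x q)

  <⇒0<- : ∀ {x y} → x < y → 0# < y - x
  <⇒0<- {x} {y} p = subst (_< y - x) (inverseʳ x) (+-monoʳ-< (- x) p)

  0<-⇒< : ∀ {x y} → 0# < y - x → x < y
  0<-⇒< {x} {y} p = +-cancelʳ-< (- x) (subst (_< y - x) (sym (inverseʳ x)) p)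

  -‿anti-< : ∀ {x y} → x < y → - y < - x
  -‿anti-< {x} {y} p = subst₂ _<_ (lemma x y) (trans (cong (y +_) (comm (- x) (- y))) (lemma y x))
                         (+-monoʳ-< (- x + - y) p)
    where
    lemma : ∀ u v → u + (- u + - v) ≡ - v
    lemma u v = trans (sym (assoc u (- u) (- v)))
                      (trans (cong (_+ - v) (inverseʳ u)) (identityˡ (- v)))

  neg⇒-pos : ∀ {x} → x < 0# → 0# < - x
  neg⇒-pos {x} p = subst (_< - x) ε⁻¹≈ε (-‿anti-< p)

  -pos⇒neg : ∀ {x} → 0# < - x → x < 0#
  -pos⇒neg {x} p = subst₂ _<_ (⁻¹-involutive x) ε⁻¹≈ε (-‿anti-< p)

  ·-zeroʳ : ∀ m → m · 0# ≡ 0#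
  ·-zeroʳ zero    = refl
  ·-zeroʳ (suc m) = trans (identityˡ _) (·-zeroʳ m)

  ·-neg : ∀ m x → m · (- x) ≡ - (m · x)
  ·-neg zero    x = sym ε⁻¹≈ε
  ·-neg (suc m) x = trans (cong (- x +_) (·-neg m x)) (sym (-‿distrib-+ x _))

  ·-distrib-- : ∀ m x y → m · (x - y) ≡ m · x - m · y
  ·-distrib-- m x y = trans (×-distrib-+ x (- y) m) (cong (m · x +_) (·-neg m y))

  ·-comm : ∀ m k x → m · (k · x) ≡ k · (m · x)
  ·-comm m k x = begin
    m · (k · x)    ≡⟨ ×-assocˡ x m k ⟩
    (m ℕ.* k) · x  ≡⟨ cong (_· x) (ℕP.*-comm m k) ⟩
    (k ℕ.* m) · x  ≡⟨ ×-assocˡ x k m ⟨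
    k · (m · x)    ∎
    where open ≡-Reasoning

  ·-pos : ∀ m {x} → 0# < x → 0# < suc m · x
  ·-pos zero    {x} p = subst (0# <_) (sym (identityʳ x)) p
  ·-pos (suc m)     p = +-pos p (·-pos m p)

  ·-pos⁻ : ∀ m {x} → 0# < suc m · x → 0# < x
  ·-pos⁻ m {x} p with compare 0# x
  ... | tri< 0<x _ _  = 0<x
  ... | tri≈ _ refl _ = ⊥-elim (<-irrefl (subst (0# <_) (·-zeroʳ (suc m)) p))
  ... | tri> _ _ x<0  = ⊥-elim (<-asym p (-pos⇒neg (subst (0# <_) (·-neg (suc m) x) (·-pos m (neg⇒-pos x<0)))))

  ·-monoʳ-< : ∀ m {x y} → x < y → suc m · x < suc m · y
  ·-monoʳ-< m {x} {y} p = 0<-⇒< (subst (0# <_) (·-distrib-- (suc m) y x) (·-pos m (<⇒0<- p)))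

  ·-cancelʳ-< : ∀ m {x y} → suc m · x < suc m · y → x < y
  ·-cancelʳ-< m {x} {y} p = 0<-⇒< (·-pos⁻ m (subst (0# <_) (sym (·-distrib-- (suc m) y x)) (<⇒0<- p)))

  ·-injective : ∀ m {x y} → suc m · x ≡ suc m · y → x ≡ y
  ·-injective m {x} {y} p with compare x y
  ... | tri< x<y _ _ = ⊥-elim (<⇒≢ (·-monoʳ-< m x<y) p)
  ... | tri≈ _ x≡y _ = x≡y
  ... | tri> _ _ y<x = ⊥-elim (<⇒≢ (·-monoʳ-< m y<x) (sym p))

  ·-zero⁻ : ∀ m {x} → suc m · x ≡ 0# → x ≡ 0#
  ·-zero⁻ m p = ·-injective m (trans p (sym (·-zeroʳ (suc m))))

  nontrivial⇒positive : Nontrivial → ∃ λ t → 0# < t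
  nontrivial⇒positive (x , x≢0) with compare 0# x
  ... | tri< 0<x _ _ = x , 0<x
  ... | tri≈ _ 0≡x _ = ⊥-elim (x≢0 (sym 0≡x))
  ... | tri> _ _ x<0 = - x , neg⇒-pos x<0

  ·-monoˡ-< : ∀ {t} → 0# < t → ∀ {m m'} → m ℕ.< m' → m · t < m' · t
  ·-monoˡ-< {t} 0<t {m} {m'} m<m' with ℕP.m≤n⇒∃[o]m+o≡n m<m'
  ... | o , m+1+o≡m' = subst (λ j → m · t < j · t) (trans (ℕP.+-suc m o) m+1+o≡m')
                         (subst (m · t <_) (sym (×-homo-+ t m (suc o))) (x<x+y (m · t) (·-pos o 0<t)))

  ·-cancelˡ-≡ : ∀ {t} → 0# < t → ∀ {m m'} → m · t ≡ m' · t → m ≡ m'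
  ·-cancelˡ-≡ 0<t {m} {m'} eq with ℕP.<-cmp m m'
  ... | tri< m<m' _ _ = ⊥-elim (<⇒≢ (·-monoˡ-< 0<t m<m') eq)
  ... | tri≈ _ m≡m' _ = m≡m'
  ... | tri> _ _ m'<m = ⊥-elim (<⇒≢ (·-monoˡ-< 0<t m'<m) (sym eq))

module LinearConstraints (D : LinOrdAbGroup) where
  open OrderedGroupProperties D public

  -- A coefficient (p , q) stands for the integer p − q; working with the pair
  -- avoids any case analysis on signs.
  Coeff : Set
  Coeff = ℕ × ℕ

  infixr 8 _⊛_
  _⊛_ : Coeff → Dc → Dc
  (p , q) ⊛ x = p · x - q · x

  ⊛-+ : ∀ p q p' q' x → (p ℕ.+ p' , q ℕ.+ q') ⊛ x ≡ (p , q) ⊛ x + (p' , q') ⊛ x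
  ⊛-+ p q p' q' x = begin
    (p ℕ.+ p') · x - (q ℕ.+ q') · x          ≡⟨ cong₂ _-_ (×-homo-+ x p p') (×-homo-+ x q q') ⟩
    (p · x + p' · x) - (q · x + q' · x)       ≡⟨ cong ((p · x + p' · x) +_) (-‿distrib-+ _ _) ⟩
    (p · x + p' · x) + (- (q · x) + - (q' · x)) ≡⟨ interchange _ _ _ _ ⟩
    (p , q) ⊛ x + (p' , q') ⊛ x               ∎
    where open ≡-Reasoning

  ⊛-swap : ∀ p q x → (q , p) ⊛ x ≡ - ((p , q) ⊛ x)
  ⊛-swap p q x = begin
    q · x - p · x             ≡⟨ comm _ _ ⟩
    - (p · x) + q · x         ≡⟨ cong (- (p · x) +_) (⁻¹-involutive _) ⟨
    - (p · x) + - - (q · x)   ≡⟨ -‿distrib-+ _ _ ⟨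
    - ((p , q) ⊛ x)           ∎
    where open ≡-Reasoning

  ⊛-* : ∀ m p q x → (m ℕ.* p , m ℕ.* q) ⊛ x ≡ m · (p , q) ⊛ x
  ⊛-* m p q x = trans (cong₂ _-_ (sym (×-assocˡ x m p)) (sym (×-assocˡ x m q))) (sym (·-distrib-- m _ _))

  ⊛-0 : ∀ x → (0 , 0) ⊛ x ≡ 0#
  ⊛-0 x = inverseʳ 0#

  ⊛-1 : ∀ x → (1 , 0) ⊛ x ≡ x
  ⊛-1 x = trans (cong₂ _+_ (identityʳ x) ε⁻¹≈ε) (identityʳ x)

  ⊛-diag-+ : ∀ m x y → (m , m) ⊛ x + y ≡ y
  ⊛-diag-+ m x y = trans (cong (_+ y) (inverseʳ (m · x))) (identityˡ y)

  ⊛-> : ∀ m k x → (suc (m ℕ.+ k) , m) ⊛ x ≡ suc k · x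
  ⊛-> m k x = begin
    suc (m ℕ.+ k) · x - m · x      ≡⟨ cong (λ j → j · x - m · x) (ℕP.+-suc m k) ⟨
    (m ℕ.+ suc k) · x - m · x      ≡⟨ cong (_- m · x) (×-homo-+ x m (suc k)) ⟩
    (m · x + suc k · x) - m · x    ≡⟨ cong (_- m · x) (comm _ _) ⟩
    (suc k · x + m · x) - m · x    ≡⟨ assoc _ _ _ ⟩
    suc k · x + (m · x - m · x)    ≡⟨ cong (suc k · x +_) (inverseʳ _) ⟩
    suc k · x + 0#                 ≡⟨ identityʳ _ ⟩
    suc k · x                      ∎
    where open ≡-Reasoning

  ⊛-< : ∀ m k x → (m , suc (m ℕ.+ k)) ⊛ x ≡ - (suc k · x)
  ⊛-< m k x = trans (⊛-swap (suc (m ℕ.+ k)) m x) (cong -_ (⊛-> m k x))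

  data Form : ℕ → Set where
    cst : Dc → Form zero
    _▸_ : ∀ {k} → Coeff → Form k → Form (suc k)

  Env : ℕ → Set
  Env = Vector Dc

  eval : ∀ {k} → Form k → Env k → Dc
  eval (cst d) ρ = d
  eval (c ▸ f) ρ = c ⊛ head ρ + eval f (tail ρ)

  constF : ∀ {k} → Dc → Form k
  constF {zero}  d = cst d
  constF {suc k} d = (0 , 0) ▸ constF d

  varF : ∀ {k} → Fin k → Form k
  varF Fin.zero    = (1 , 0) ▸ constF 0#
  varF (Fin.suc i) = (0 , 0) ▸ varF i

  infixl 6 _+F_ _-F_
  infix 8 -F_
  infixr 7 _·F_

  _+F_ : ∀ {k} → Form k → Form k → Form k
  cst a         +F cst b           = cst (a + b)
  ((p , q) ▸ f) +F ((p' , q') ▸ g) = (p ℕ.+ p' , q ℕ.+ q') ▸ (f +F g)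

  -F_ : ∀ {k} → Form k → Form k
  -F cst a          = cst (- a)
  -F ((p , q) ▸ f)  = (q , p) ▸ (-F f)

  _·F_ : ∀ {k} → ℕ → Form k → Form k
  m ·F cst a         = cst (m · a)
  m ·F ((p , q) ▸ f) = (m ℕ.* p , m ℕ.* q) ▸ (m ·F f)

  _-F_ : ∀ {k} → Form k → Form k → Form k
  f -F g = f +F (-F g)

  eval-const : ∀ {k} d (ρ : Env k) → eval (constF d) ρ ≡ d
  eval-const {zero}  d ρ = refl
  eval-const {suc k} d ρ = trans (cong₂ _+_ (⊛-0 (head ρ)) (eval-const d (tail ρ))) (identityˡ d)

  eval-var : ∀ {k} (i : Fin k) ρ → eval (varF i) ρ ≡ ρ i
  eval-var Fin.zero    ρ = trans (cong₂ _+_ (⊛-1 (head ρ)) (eval-const 0# (tail ρ))) (identityʳ _)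
  eval-var (Fin.suc i) ρ = trans (cong₂ _+_ (⊛-0 (head ρ)) (eval-var i (tail ρ))) (identityˡ _)

  eval-+ : ∀ {k} (f g : Form k) ρ → eval (f +F g) ρ ≡ eval f ρ + eval g ρ
  eval-+ (cst a)         (cst b)           ρ = refl
  eval-+ ((p , q) ▸ f) ((p' , q') ▸ g) ρ =
    trans (cong₂ _+_ (⊛-+ p q p' q' _) (eval-+ f g (tail ρ))) (interchange _ _ _ _)

  eval-neg : ∀ {k} (f : Form k) ρ → eval (-F f) ρ ≡ - eval f ρ
  eval-neg (cst a)       ρ = refl
  eval-neg ((p , q) ▸ f) ρ = trans (cong₂ _+_ (⊛-swap p q _) (eval-neg f (tail ρ))) (sym (-‿distrib-+ _ _))

  eval-· : ∀ {k} m (f : Form k) ρ → eval (m ·F f) ρ ≡ m · eval f ρ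
  eval-· m (cst a)       ρ = refl
  eval-· m ((p , q) ▸ f) ρ =
    trans (cong₂ _+_ (⊛-* m p q _) (eval-· m f (tail ρ))) (sym (×-distrib-+ _ _ m))

  eval-- : ∀ {k} (f g : Form k) ρ → eval (f -F g) ρ ≡ eval f ρ - eval g ρ
  eval-- f g ρ = trans (eval-+ f (-F g) ρ) (cong (eval f ρ +_) (eval-neg g ρ))

  data Lit (k : ℕ) : Set where
    pos eq0 : Form k → Lit k

  SatL : ∀ {k} → Env k → Lit k → Set
  SatL ρ (pos f) = 0# < eval f ρ
  SatL ρ (eq0 f) = eval f ρ ≡ 0#

  Clause : ℕ → Set
  Clause k = List (Lit k)

  DNF : ℕ → Set
  DNF k = List (Clause k)

  SatC : ∀ {k} → Env k → Clause k → Set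
  SatC ρ = All (SatL ρ)

  SatD : ∀ {k} → Env k → DNF k → Set
  SatD ρ = Any (SatC ρ)

  SatL? : ∀ {k} (ρ : Env k) l → Dec (SatL ρ l)
  SatL? ρ (pos f) with compare 0# (eval f ρ)
  ... | tri< a ¬b ¬c = yes a
  ... | tri≈ ¬a b ¬c = no ¬a
  ... | tri> ¬a ¬b c = no ¬a
  SatL? ρ (eq0 f) with compare (eval f ρ) 0#
  ... | tri< a ¬b ¬c = no ¬b
  ... | tri≈ ¬a b ¬c = yes b
  ... | tri> ¬a ¬b c = no ¬b

  SatC? : ∀ {k} (ρ : Env k) c → Dec (SatC ρ c)
  SatC? ρ = All.all? (SatL? ρ)

  SatD? : ∀ {k} (ρ : Env k) ds → Dec (SatD ρ ds)
  SatD? ρ = Any.any? (SatC? ρ)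

  _∧D_ : ∀ {k} → DNF k → DNF k → DNF k
  _∧D_ = cartesianProductWith _++_

  sat-∧D : ∀ {k} {ρ : Env k} ds es → SatD ρ (ds ∧D es) ⇔ (SatD ρ ds × SatD ρ es)
  sat-∧D ds es = mk⇔ (Anyₚ.cartesianProductWith⁻ _++_ (λ {c} → Allₚ.++⁻ c) ds es)
                     (uncurry (Anyₚ.cartesianProductWith⁺ _++_ Allₚ.++⁺))

  sat-++ : ∀ {k} {ρ : Env k} ds es → SatD ρ (ds ++ es) ⇔ (SatD ρ ds ⊎ SatD ρ es)
  sat-++ ds es = mk⇔ (Anyₚ.++⁻ ds) [ Anyₚ.++⁺ˡ , Anyₚ.++⁺ʳ ds ]′

  sat-single : ∀ {k} {ρ : Env k} l → SatD ρ ((l ∷ []) ∷ []) ⇔ SatL ρ l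
  sat-single l = mk⇔ (λ { (here (s ∷ [])) → s }) (λ s → here (s ∷ []))

  guard : ∀ {k} {A : Set} → Dec A → DNF k
  guard (yes _) = [] ∷ []
  guard (no _)  = []

  sat-guard : ∀ {k} {ρ : Env k} {A : Set} (a? : Dec A) → SatD ρ (guard a?) ⇔ A
  sat-guard (yes a) = mk⇔ (λ _ → a) (λ _ → here [])
  sat-guard (no ¬a) = mk⇔ (λ ()) (⊥-elim ∘ ¬a)

  ¬L : ∀ {k} → Lit k → DNF k
  ¬L (pos f) = (eq0 f ∷ []) ∷ (pos (-F f) ∷ []) ∷ []
  ¬L (eq0 f) = (pos f ∷ []) ∷ (pos (-F f) ∷ []) ∷ []

  ¬L-intro : ∀ {k} (ρ : Env k) l → ¬ SatL ρ l → SatD ρ (¬L l)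
  ¬L-intro ρ (pos f) ¬sat with compare 0# (eval f ρ)
  ... | tri< 0<f _ _ = ⊥-elim (¬sat 0<f)
  ... | tri≈ _ 0≡f _ = here (sym 0≡f ∷ [])
  ... | tri> _ _ f<0 = there (here (subst (0# <_) (sym (eval-neg f ρ)) (neg⇒-pos f<0) ∷ []))
  ¬L-intro ρ (eq0 f) ¬sat with compare 0# (eval f ρ)
  ... | tri< 0<f _ _ = here (0<f ∷ [])
  ... | tri≈ _ 0≡f _ = ⊥-elim (¬sat (sym 0≡f))
  ... | tri> _ _ f<0 = there (here (subst (0# <_) (sym (eval-neg f ρ)) (neg⇒-pos f<0) ∷ []))

  ¬L-elim : ∀ {k} (ρ : Env k) l → SatD ρ (¬L l) → ¬ SatL ρ l
  ¬L-elim ρ (pos f) (here (f≡0 ∷ []))          0<f = <⇒≢ 0<f (sym f≡0)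
  ¬L-elim ρ (pos f) (there (here (0<-f ∷ []))) 0<f =
    <-asym 0<f (-pos⇒neg (subst (0# <_) (eval-neg f ρ) 0<-f))
  ¬L-elim ρ (eq0 f) (here (0<f ∷ []))          f≡0 = <⇒≢ 0<f (sym f≡0)
  ¬L-elim ρ (eq0 f) (there (here (0<-f ∷ []))) f≡0 =
    <-irrefl (subst (0# <_) (trans (eval-neg f ρ) (-‿zero f≡0)) 0<-f)

  ¬C : ∀ {k} → Clause k → DNF k
  ¬C = concatMap ¬L

  ¬C-intro : ∀ {k} (ρ : Env k) c → ¬ SatC ρ c → SatD ρ (¬C c)
  ¬C-intro ρ c ¬sat = Anyₚ.concatMap⁺ ¬L (Any.map (¬L-intro ρ _) (Allₚ.¬All⇒Any¬ (SatL? ρ) c ¬sat))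

  ¬C-elim : ∀ {k} (ρ : Env k) c → SatD ρ (¬C c) → ¬ SatC ρ c
  ¬C-elim ρ c sat = Allₚ.Any¬⇒¬All (Any.map (¬L-elim ρ _) (Anyₚ.concatMap⁻ ¬L sat))

  ¬D : ∀ {k} → DNF k → DNF k
  ¬D []       = [] ∷ []
  ¬D (c ∷ ds) = ¬C c ∧D ¬D ds

  ¬D-intro : ∀ {k} (ρ : Env k) ds → ¬ SatD ρ ds → SatD ρ (¬D ds)
  ¬D-intro ρ []       ¬sat = here []
  ¬D-intro ρ (c ∷ ds) ¬sat = Equivalence.from (sat-∧D (¬C c) (¬D ds))
    (¬C-intro ρ c (¬sat ∘ here) , ¬D-intro ρ ds (¬sat ∘ there))

  ¬D-elim : ∀ {k} (ρ : Env k) ds → SatD ρ (¬D ds) → ¬ SatD ρ ds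
  ¬D-elim ρ (c ∷ ds) sat (here satc) =
    ¬C-elim ρ c (proj₁ (Equivalence.to (sat-∧D (¬C c) (¬D ds)) sat)) satc
  ¬D-elim ρ (c ∷ ds) sat (there satd) =
    ¬D-elim ρ ds (proj₂ (Equivalence.to (sat-∧D (¬C c) (¬D ds)) sat)) satd

  sat-¬D : ∀ {k} {ρ : Env k} ds → SatD ρ (¬D ds) ⇔ (¬ SatD ρ ds)
  sat-¬D {ρ = ρ} ds = mk⇔ (¬D-elim ρ ds) (¬D-intro ρ ds)

  sat-⇒D : ∀ {k} {ρ : Env k} ds es → SatD ρ (¬D ds ++ es) ⇔ (SatD ρ ds → SatD ρ es)
  sat-⇒D {ρ = ρ} ds es = mk⇔ implies (λ f → Equivalence.from (sat-++ (¬D ds) es) (cases f))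
    where
    implies : SatD ρ (¬D ds ++ es) → SatD ρ ds → SatD ρ es
    implies h with Equivalence.to (sat-++ (¬D ds) es) h
    ... | inj₁ ¬d = ⊥-elim ∘ ¬D-elim ρ ds ¬d
    ... | inj₂ e  = λ _ → e
    cases : (SatD ρ ds → SatD ρ es) → SatD ρ (¬D ds) ⊎ SatD ρ es
    cases f with SatD? ρ ds
    ... | yes d = inj₂ (f d)
    ... | no ¬d = inj₁ (¬D-intro ρ ds ¬d)

module QuantifierElimination (D : LinOrdAbGroup) (nontrivial : LinOrdAbGroup.Nontrivial D)
                             (divisible : LinOrdAbGroup.Divisible D) where
  open LinearConstraints D public

  ×ℕ≗· : ∀ m x → LinOrdAbGroup._×ℕ_ D m x ≡ m · x
  ×ℕ≗· zero    x = refl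
  ×ℕ≗· (suc m) x = cong (x +_) (×ℕ≗· m x)

  divide : ∀ m x → ∃ λ y → suc m · y ≡ x
  divide m x with divisible (suc m) (λ ()) x
  ... | y , m·y≡x = y , trans (sym (×ℕ≗· (suc m) y)) m·y≡x

  midpoint : ∀ {x y} → x < y → ∃ λ z → x < z × z < y
  midpoint {x} {y} x<y with divide 1 (x + y)
  ... | z , 2z≡x+y =
    z , ·-cancelʳ-< 1 (subst₂ _<_ (sym (twice x)) (sym 2z≡x+y) (+-monoˡ-< x x<y))
      , ·-cancelʳ-< 1 (subst₂ _<_ (sym 2z≡x+y) (sym (twice y)) (+-monoʳ-< y x<y))
    where
    twice : ∀ w → 2 · w ≡ w + w
    twice w = cong (w +_) (identityʳ w)

  totalOrder : TotalOrder _ _ _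
  totalOrder = record { isTotalOrder = StrictToNonStrict.isTotalOrder _≡_ _<_ isStrictTotalOrder }

  open TotalOrder totalOrder using (_≤_)
  open Extrema totalOrder using (max; min; ⊥≤max; xs≤max; min≤⊤; min≤xs; argmax-all; argmin-all)

  ≤-<-trans : ∀ {x y z} → x ≤ y → y < z → x < z
  ≤-<-trans (inj₁ x<y) y<z = <-trans x<y y<z
  ≤-<-trans (inj₂ refl) y<z = y<z

  <-≤-trans : ∀ {x y z} → x < y → y ≤ z → x < z
  <-≤-trans x<y (inj₁ y<z) = <-trans x<y y<z
  <-≤-trans x<y (inj₂ refl) = x<y

  max<⇒all< : ∀ {x} l ls → max l ls < x → All (_< x) (l ∷ ls)
  max<⇒all< l ls p = ≤-<-trans (⊥≤max l ls) p ∷ All.map (λ q → ≤-<-trans q p) (xs≤max l ls)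

  <min⇒all< : ∀ {x} u us → x < min u us → All (x <_) (u ∷ us)
  <min⇒all< u us p = <-≤-trans p (min≤⊤ u us) ∷ All.map (<-≤-trans p) (min≤xs u us)

  -- Nontriviality is needed when one of the two lists is empty.
  interpolate : ∀ ls us → All (λ l → All (l <_) us) ls → ∃ λ x → All (_< x) ls × All (x <_) us
  interpolate []       []       _ = 0# , [] , []
  interpolate (l ∷ ls) []       _ = let (t , 0<t) = nontrivial⇒positive nontrivial in
    max l ls + t , max<⇒all< l ls (x<x+y _ 0<t) , []
  interpolate []       (u ∷ us) _ = let (t , 0<t) = nontrivial⇒positive nontrivial in
    min u us - t , [] , <min⇒all< u us (x-y<x _ 0<t)
  interpolate (l ∷ ls) (u ∷ us) (h ∷ hs) with midpoint max<min
    where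
    below-min : ∀ {y} → All (y <_) (u ∷ us) → y < min u us
    below-min (p ∷ ps) = argmin-all id {P = _ <_} p ps
    max<min : max l ls < min u us
    max<min = argmax-all id {P = _< min u us} (below-min h) (All.map below-min hs)
  ... | x , max<x , x<min = x , max<⇒all< l ls max<x , <min⇒all< u us x<min

  -- How a literal in the variables x, x₁, …, xₖ constrains x, with the
  -- coefficient of x normalised to a positive integer d + 1.
  data View (k : ℕ) : Set where
    free                  : Lit k → View k
    equation lower upper  : ℕ → Form k → View k

  SatV : ∀ {k} → Dc → Env k → View k → Set
  SatV x ρ (free l)       = SatL ρ l
  SatV x ρ (equation d f) = suc d · x + eval f ρ ≡ 0#
  SatV x ρ (lower d f)    = 0# < suc d · x + eval f ρ
  SatV x ρ (upper d f)    = suc d · x < eval f ρ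

  view : ∀ {k} → Lit (suc k) → View k
  view (pos ((p , q) ▸ f)) with ℕ.compare p q
  ... | ℕ.less    _ d = upper d f
  ... | ℕ.equal   _   = free (pos f)
  ... | ℕ.greater _ d = lower d f
  view (eq0 ((p , q) ▸ f)) with ℕ.compare p q
  ... | ℕ.less    _ d = equation d (-F f)
  ... | ℕ.equal   _   = free (eq0 f)
  ... | ℕ.greater _ d = equation d f

  view-correct : ∀ {k} x (ρ : Env k) l → SatL (x ∷ᵥ ρ) l ⇔ SatV x ρ (view l)
  view-correct x ρ (pos ((p , q) ▸ f)) with ℕ.compare p q
  ... | ℕ.less m d = mk⇔ (0<-⇒< ∘ subst (0# <_) key) (subst (0# <_) (sym key) ∘ <⇒0<-)
    where
    key : (m , suc (m ℕ.+ d)) ⊛ x + eval f ρ ≡ eval f ρ - suc d · x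
    key = trans (cong (_+ eval f ρ) (⊛-< m d x)) (comm _ _)
  ... | ℕ.equal m = mk⇔ (subst (0# <_) (⊛-diag-+ m x _)) (subst (0# <_) (sym (⊛-diag-+ m x _)))
  ... | ℕ.greater m d = mk⇔ (subst (λ z → 0# < z + eval f ρ) (⊛-> m d x))
                            (subst (λ z → 0# < z + eval f ρ) (sym (⊛-> m d x)))
  view-correct x ρ (eq0 ((p , q) ▸ f)) with ℕ.compare p q
  ... | ℕ.less m d = mk⇔ (trans key ∘ -‿zero) (-‿zero⁻¹ ∘ trans (sym key))
    where
    key : suc d · x + eval (-F f) ρ ≡ - ((m , suc (m ℕ.+ d)) ⊛ x + eval f ρ)
    key = begin
      suc d · x + eval (-F f) ρ                ≡⟨ cong (suc d · x +_) (eval-neg f ρ) ⟩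
      suc d · x + - eval f ρ                   ≡⟨ cong (_+ - eval f ρ) (⁻¹-involutive _) ⟨
      - - (suc d · x) + - eval f ρ             ≡⟨ -‿distrib-+ _ _ ⟨
      - (- (suc d · x) + eval f ρ)             ≡⟨ cong (λ z → - (z + eval f ρ)) (⊛-< m d x) ⟨
      - ((m , suc (m ℕ.+ d)) ⊛ x + eval f ρ)   ∎
      where open ≡-Reasoning
  ... | ℕ.equal m = mk⇔ (trans (sym (⊛-diag-+ m x _))) (trans (⊛-diag-+ m x _))
  ... | ℕ.greater m d = mk⇔ (trans (cong (_+ eval f ρ) (sym (⊛-> m d x))))
                            (trans (cong (_+ eval f ρ) (⊛-> m d x)))

  -- Multiply the constraint by d + 1 and replace (d + 1)·x by −f.
  substitute : ∀ {k} → ℕ → Form k → View k → Lit k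
  substitute d f (free l)         = l
  substitute d f (equation d' f') = eq0 (suc d ·F f' -F suc d' ·F f)
  substitute d f (lower d' f')    = pos (suc d ·F f' -F suc d' ·F f)
  substitute d f (upper d' f')    = pos (suc d ·F f' +F suc d' ·F f)

  module _ {k} (d : ℕ) (f : Form k) (ρ : Env k) {x : Dc} (solves : suc d · x + eval f ρ ≡ 0#) where
    private
      F = eval f ρ

      dx≡-F : suc d · x ≡ - F
      dx≡-F = inverseʳ-unique F _ (trans (comm _ _) solves)

      d·d'x≡-d'F : ∀ d' → suc d · (suc d' · x) ≡ - (suc d' · F)
      d·d'x≡-d'F d' = trans (·-comm (suc d) (suc d') x) (trans (cong (suc d' ·_) dx≡-F) (·-neg (suc d') F))

    eval-substitute-lower : ∀ d' f' →
      eval (suc d ·F f' -F suc d' ·F f) ρ ≡ suc d · (suc d' · x + eval f' ρ)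
    eval-substitute-lower d' f' = begin
      eval (suc d ·F f' -F suc d' ·F f) ρ       ≡⟨ eval-- (suc d ·F f') (suc d' ·F f) ρ ⟩
      eval (suc d ·F f') ρ - eval (suc d' ·F f) ρ ≡⟨ cong₂ _-_ (eval-· (suc d) f' ρ) (eval-· (suc d') f ρ) ⟩
      suc d · F' - suc d' · F                   ≡⟨ comm _ _ ⟩
      - (suc d' · F) + suc d · F'               ≡⟨ cong (_+ suc d · F') (d·d'x≡-d'F d') ⟨
      suc d · (suc d' · x) + suc d · F'         ≡⟨ ×-distrib-+ _ _ (suc d) ⟨
      suc d · (suc d' · x + F')                 ∎
      where open ≡-Reasoning
            F' = eval f' ρ

    eval-substitute-upper : ∀ d' f' →
      eval (suc d ·F f' +F suc d' ·F f) ρ ≡ suc d · (eval f' ρ - suc d' · x)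
    eval-substitute-upper d' f' = begin
      eval (suc d ·F f' +F suc d' ·F f) ρ        ≡⟨ eval-+ (suc d ·F f') (suc d' ·F f) ρ ⟩
      eval (suc d ·F f') ρ + eval (suc d' ·F f) ρ ≡⟨ cong₂ _+_ (eval-· (suc d) f' ρ) (eval-· (suc d') f ρ) ⟩
      suc d · F' + suc d' · F                    ≡⟨ cong (suc d · F' +_) (⁻¹-involutive _) ⟨
      suc d · F' - - (suc d' · F)                ≡⟨ cong (λ z → suc d · F' - z) (d·d'x≡-d'F d') ⟨
      suc d · F' - suc d · (suc d' · x)          ≡⟨ ·-distrib-- (suc d) _ _ ⟨
      suc d · (F' - suc d' · x)                  ∎
      where open ≡-Reasoning
            F' = eval f' ρ

    substitute-correct : ∀ v → SatV x ρ v ⇔ SatL ρ (substitute d f v)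
    substitute-correct (free l) = mk⇔ id id
    substitute-correct (equation d' f') = mk⇔
      (λ h → trans (eval-substitute-lower d' f') (trans (cong (suc d ·_) h) (·-zeroʳ (suc d))))
      (λ h → ·-zero⁻ d (trans (sym (eval-substitute-lower d' f')) h))
    substitute-correct (lower d' f') = mk⇔
      (subst (0# <_) (sym (eval-substitute-lower d' f')) ∘ ·-pos d)
      (·-pos⁻ d ∘ subst (0# <_) (eval-substitute-lower d' f'))
    substitute-correct (upper d' f') = mk⇔
      (subst (0# <_) (sym (eval-substitute-upper d' f')) ∘ ·-pos d ∘ <⇒0<-)
      (0<-⇒< ∘ ·-pos⁻ d ∘ subst (0# <_) (eval-substitute-upper d' f'))

  ∃-equation : ∀ {k} d f (ρ : Env k) vs → equation d f ∈ vs →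
               (∃ λ x → All (SatV x ρ) vs) ⇔ All (SatL ρ) (map (substitute d f) vs)
  ∃-equation d f ρ vs eq∈vs = mk⇔
    (λ (x , h) → let solves = All.lookup h eq∈vs in
      Allₚ.map⁺ (All.map (λ {v} → Equivalence.to (substitute-correct d f ρ solves v)) h))
    (λ h → let (x , solves) = solution in
      x , All.map (λ {v} → Equivalence.from (substitute-correct d f ρ solves v)) (Allₚ.map⁻ h))
    where
    solution : ∃ λ x → suc d · x + eval f ρ ≡ 0#
    solution = let (x , dx≡-f) = divide d (- eval f ρ) in
      x , trans (cong (_+ eval f ρ) dx≡-f) (inverseˡ _)

  NotEquation : ∀ {k} → View k → Set
  NotEquation (equation _ _) = ⊥
  NotEquation _              = ⊤

  frees : ∀ {k} → List (View k) → Clause k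
  frees []                  = []
  frees (free l ∷ vs)       = l ∷ frees vs
  frees (equation _ _ ∷ vs) = frees vs
  frees (lower _ _ ∷ vs)    = frees vs
  frees (upper _ _ ∷ vs)    = frees vs

  lowers : ∀ {k} → List (View k) → List (ℕ × Form k)
  lowers []                  = []
  lowers (free _ ∷ vs)       = lowers vs
  lowers (equation _ _ ∷ vs) = lowers vs
  lowers (lower d f ∷ vs)    = (d , f) ∷ lowers vs
  lowers (upper _ _ ∷ vs)    = lowers vs

  uppers : ∀ {k} → List (View k) → List (ℕ × Form k)
  uppers []                  = []
  uppers (free _ ∷ vs)       = uppers vs
  uppers (equation _ _ ∷ vs) = uppers vs
  uppers (lower _ _ ∷ vs)    = uppers vs
  uppers (upper d f ∷ vs)    = (d , f) ∷ uppers vs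

  -- 0 < (a + 1)x + f and (b + 1)x < g together give 0 < (b + 1)f + (a + 1)g.
  combine : ∀ {k} → ℕ × Form k → ℕ × Form k → Lit k
  combine (a , f) (b , g) = pos (suc b ·F f +F suc a ·F g)

  fourierMotzkin : ∀ {k} → List (View k) → Clause k
  fourierMotzkin vs = frees vs ++ cartesianProductWith combine (lowers vs) (uppers vs)

  module FourierMotzkin {k} (ρ : Env k) where
    Lower Upper : Dc → ℕ × Form k → Set
    Lower x (a , f) = 0# < suc a · x + eval f ρ
    Upper x (b , g) = suc b · x < eval g ρ

    split : ∀ x vs → All (SatV x ρ) vs →
            All (SatL ρ) (frees vs) × All (Lower x) (lowers vs) × All (Upper x) (uppers vs)
    split x []                  []       = [] , [] , []
    split x (free _ ∷ vs)       (p ∷ ps) = let (fs , ls , us) = split x vs ps in p ∷ fs , ls , us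
    split x (equation _ _ ∷ vs) (p ∷ ps) = split x vs ps
    split x (lower _ _ ∷ vs)    (p ∷ ps) = let (fs , ls , us) = split x vs ps in fs , p ∷ ls , us
    split x (upper _ _ ∷ vs)    (p ∷ ps) = let (fs , ls , us) = split x vs ps in fs , ls , p ∷ us

    join : ∀ x vs → All NotEquation vs → All (SatL ρ) (frees vs) →
           All (Lower x) (lowers vs) → All (Upper x) (uppers vs) → All (SatV x ρ) vs
    join x []                  []       _        _        _        = []
    join x (free _ ∷ vs)       (_ ∷ ne) (f ∷ fs) ls       us       = f ∷ join x vs ne fs ls us
    join x (equation _ _ ∷ vs) (() ∷ _) _        _        _
    join x (lower _ _ ∷ vs)    (_ ∷ ne) fs       (l ∷ ls) us       = l ∷ join x vs ne fs ls us
    join x (upper _ _ ∷ vs)    (_ ∷ ne) fs       ls       (u ∷ us) = u ∷ join x vs ne fs ls us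

    eval-combine : ∀ a f b g →
      eval (suc b ·F f +F suc a ·F g) ρ ≡ suc b · eval f ρ + suc a · eval g ρ
    eval-combine a f b g =
      trans (eval-+ (suc b ·F f) (suc a ·F g) ρ) (cong₂ _+_ (eval-· (suc b) f ρ) (eval-· (suc a) g ρ))

    combine-sound : ∀ x l u → Lower x l → Upper x u → SatL ρ (combine l u)
    combine-sound x (a , f) (b , g) lo up =
      subst (0# <_) (trans eq (sym (eval-combine a f b g))) (+-pos scaled-lo scaled-up)
      where
      A = suc a ; B = suc b ; F = eval f ρ ; G = eval g ρ
      scaled-lo : 0# < B · (A · x) + B · F
      scaled-lo = subst (0# <_) (×-distrib-+ _ _ B) (·-pos b lo)
      scaled-up : 0# < A · G - A · (B · x)
      scaled-up = subst (0# <_) (·-distrib-- A _ _) (·-pos a (<⇒0<- up))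
      eq : (B · (A · x) + B · F) + (A · G - A · (B · x)) ≡ B · F + A · G
      eq = trans (cong (λ z → (z + B · F) + (A · G - A · (B · x))) (·-comm B A x)) (+-cancel-middle _ _ _)

    lowerBound upperBound : ℕ × Form k → Dc
    lowerBound (a , f) = proj₁ (divide a (- eval f ρ))
    upperBound (b , g) = proj₁ (divide b (eval g ρ))

    f≡-a·lowerBound : ∀ a f → eval f ρ ≡ - (suc a · lowerBound (a , f))
    f≡-a·lowerBound a f =
      sym (trans (cong -_ (proj₂ (divide a (- eval f ρ)))) (⁻¹-involutive _))

    g≡b·upperBound : ∀ b g → eval g ρ ≡ suc b · upperBound (b , g)
    g≡b·upperBound b g = sym (proj₂ (divide b (eval g ρ)))

    combine-complete : ∀ l u → SatL ρ (combine l u) → lowerBound l < upperBound u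
    combine-complete (a , f) (b , g) h = 0<-⇒< (·-pos⁻ a (·-pos⁻ b (subst (0# <_) eq h)))
      where
      A = suc a ; B = suc b ; l = lowerBound (a , f) ; u = upperBound (b , g)
      eq : eval (suc b ·F f +F suc a ·F g) ρ ≡ B · (A · (u - l))
      eq = begin
        eval (suc b ·F f +F suc a ·F g) ρ   ≡⟨ eval-combine a f b g ⟩
        B · eval f ρ + A · eval g ρ         ≡⟨ cong₂ (λ z w → B · z + A · w) (f≡-a·lowerBound a f)
                                                                               (g≡b·upperBound b g) ⟩
        B · (- (A · l)) + A · (B · u)       ≡⟨ cong₂ _+_ (·-neg B _) (·-comm A B u) ⟩
        - (B · (A · l)) + B · (A · u)       ≡⟨ comm _ _ ⟩
        B · (A · u) - B · (A · l)           ≡⟨ ·-distrib-- B _ _ ⟨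
        B · (A · u - A · l)                 ≡⟨ cong (B ·_) (·-distrib-- A u l) ⟨
        B · (A · (u - l))                   ∎
        where open ≡-Reasoning

    above-lowerBound : ∀ x l → lowerBound l < x → Lower x l
    above-lowerBound x (a , f) h = subst (0# <_) eq (·-pos a (<⇒0<- h))
      where
      eq : suc a · (x - lowerBound (a , f)) ≡ suc a · x + eval f ρ
      eq = trans (·-distrib-- (suc a) x _) (cong (suc a · x +_) (sym (f≡-a·lowerBound a f)))

    below-upperBound : ∀ x u → x < upperBound u → Upper x u
    below-upperBound x (b , g) h = subst (suc b · x <_) (sym (g≡b·upperBound b g)) (·-monoʳ-< b h)

    ∃-noEquation : ∀ vs → All NotEquation vs →
                   (∃ λ x → All (SatV x ρ) vs) ⇔ All (SatL ρ) (fourierMotzkin vs)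
    ∃-noEquation vs ne = mk⇔ sound complete
      where
      ls = lowers vs ; us = uppers vs

      sound : (∃ λ x → All (SatV x ρ) vs) → All (SatL ρ) (fourierMotzkin vs)
      sound (x , h) = let (fs , los , ups) = split x vs h in
        Allₚ.++⁺ fs (Allₚ.cartesianProductWith⁺ (setoid _) (setoid _) combine ls us
                       (λ {l} {u} l∈ u∈ → combine-sound x l u (All.lookup los l∈) (All.lookup ups u∈)))

      complete : All (SatL ρ) (fourierMotzkin vs) → ∃ λ x → All (SatV x ρ) vs
      complete h with Allₚ.++⁻ (frees vs) h
      ... | fs , pairs with interpolate (map lowerBound ls) (map upperBound us) separated
        where
        separated : All (λ l → All (l <_) (map upperBound us)) (map lowerBound ls)
        separated = Allₚ.map⁺ (All.tabulate λ {l} l∈ → Allₚ.map⁺ (All.tabulate λ {u} u∈ →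
          combine-complete l u (All.lookup pairs (∈-cartesianProductWith⁺ combine l∈ u∈))))
      ... | x , ls<x , x<us = x , join x vs ne fs (All.map (λ {l} → above-lowerBound x l) (Allₚ.map⁻ ls<x))
                                                  (All.map (λ {u} → below-upperBound x u) (Allₚ.map⁻ x<us))

  data EquationIn {k} : List (View k) → Set where
    found : ∀ {vs} d f → equation d f ∈ vs → EquationIn vs
    none  : ∀ {vs} → All NotEquation vs → EquationIn vs

  skip : ∀ {k} {v : View k} {vs} → NotEquation v → EquationIn vs → EquationIn (v ∷ vs)
  skip _  (found d f e∈) = found d f (there e∈)
  skip ne (none nes)     = none (ne ∷ nes)

  equationIn : ∀ {k} (vs : List (View k)) → EquationIn vs
  equationIn []                  = none []
  equationIn (equation d f ∷ vs) = found d f (here refl)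
  equationIn (free _ ∷ vs)       = skip tt (equationIn vs)
  equationIn (lower _ _ ∷ vs)    = skip tt (equationIn vs)
  equationIn (upper _ _ ∷ vs)    = skip tt (equationIn vs)

  eliminate : ∀ {k} (vs : List (View k)) → EquationIn vs → Clause k
  eliminate vs (found d f _) = map (substitute d f) vs
  eliminate vs (none _)      = fourierMotzkin vs

  eliminate-correct : ∀ {k} (ρ : Env k) vs (e : EquationIn vs) →
                      (∃ λ x → All (SatV x ρ) vs) ⇔ All (SatL ρ) (eliminate vs e)
  eliminate-correct ρ vs (found d f e∈) = ∃-equation d f ρ vs e∈
  eliminate-correct ρ vs (none ne)      = FourierMotzkin.∃-noEquation ρ vs ne

  views-correct : ∀ {k} x (ρ : Env k) c → SatC (x ∷ᵥ ρ) c ⇔ All (SatV x ρ) (map view c)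
  views-correct x ρ c = mk⇔
    (Allₚ.map⁺ ∘ All.map (λ {l} → Equivalence.to (view-correct x ρ l)))
    (All.map (λ {l} → Equivalence.from (view-correct x ρ l)) ∘ Allₚ.map⁻)

  ∃C : ∀ {k} → Clause (suc k) → Clause k
  ∃C c = eliminate (map view c) (equationIn (map view c))

  ∃C-correct : ∀ {k} (ρ : Env k) c → (∃ λ x → SatC (x ∷ᵥ ρ) c) ⇔ SatC ρ (∃C c)
  ∃C-correct ρ c = ⇔.trans
    (mk⇔ (λ (x , h) → x , Equivalence.to (views-correct x ρ c) h)
         (λ (x , h) → x , Equivalence.from (views-correct x ρ c) h))
    (eliminate-correct ρ (map view c) (equationIn (map view c)))

  ∃D : ∀ {k} → DNF (suc k) → DNF k
  ∃D = map ∃C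

  ∃D-correct : ∀ {k} (ρ : Env k) ds → (∃ λ x → SatD (x ∷ᵥ ρ) ds) ⇔ SatD ρ (∃D ds)
  ∃D-correct ρ ds = mk⇔
    (λ (x , h) → Anyₚ.map⁺ (Any.map (λ {c} s → Equivalence.to (∃C-correct ρ c) (x , s)) h))
    (pull ∘ Any.map (λ {c} → Equivalence.from (∃C-correct ρ c)) ∘ Anyₚ.map⁻)
    where
    pull : ∀ {cs} → Any (λ c → ∃ λ x → SatC (x ∷ᵥ ρ) c) cs → ∃ λ x → SatD (x ∷ᵥ ρ) cs
    pull (here (x , s)) = x , here s
    pull (there p)      = let (x , s) = pull p in x , there s

  convex-view : ∀ (v : View 0) {a b c} → a < c → c < b → SatV a []ᵥ v → SatV b []ᵥ v → SatV c []ᵥ v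
  convex-view (free l)       a<c c<b sa sb = sa
  convex-view (equation d f) a<c c<b sa sb =
    ⊥-elim (<⇒≢ (<-trans a<c c<b) (·-injective d (∙-cancelʳ (eval f []ᵥ) _ _ (trans sa (sym sb)))))
  convex-view (lower d f)    a<c c<b sa sb = <-trans sa (+-monoʳ-< (eval f []ᵥ) (·-monoʳ-< d a<c))
  convex-view (upper d f)    a<c c<b sa sb = <-trans (·-monoʳ-< d c<b) sb

  convex-clause : ∀ (cl : Clause 1) {a b c} → a < c → c < b →
                  SatC (a ∷ᵥ []ᵥ) cl → SatC (b ∷ᵥ []ᵥ) cl → SatC (c ∷ᵥ []ᵥ) cl
  convex-clause []       a<c c<b []       []       = []
  convex-clause (l ∷ cl) a<c c<b (sa ∷ sas) (sb ∷ sbs) =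
    Equivalence.from (view-correct _ []ᵥ l)
      (convex-view (view l) a<c c<b (Equivalence.to (view-correct _ []ᵥ l) sa)
                                    (Equivalence.to (view-correct _ []ᵥ l) sb))
    ∷ convex-clause cl a<c c<b sas sbs

module CyclicGroup (n : ℕ) .{{_ : NonZero n}} where
  open CStr (TU n) public using () renaming (_∙_ to infixl 6 _⊕_; e to 0ₙ; _⁻¹ to infix 8 ⊖_)

  open CyclicClosure (FP.<-isStrictTotalOrder {n}) public using ()
    renaming (Cyclic to Cyclicₙ; cyclic? to cyclicₙ?; cyc-rotate to cycₙ-rotate)

  toℕ-modn : ∀ m → toℕ (modn n m) ≡ m % n
  toℕ-modn m = FP.toℕ-fromℕ< (m%n<n m n)

  modn-cong : ∀ {x y} → x % n ≡ y % n → modn n x ≡ modn n y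
  modn-cong eq = FP.toℕ-injective (trans (toℕ-modn _) (trans eq (sym (toℕ-modn _))))

  modn-toℕ : ∀ a → modn n (toℕ a) ≡ a
  modn-toℕ a = FP.toℕ-injective (trans (toℕ-modn _) (m<n⇒m%n≡m (FP.toℕ<n a)))

  %-absorbˡ : ∀ x y → (x % n ℕ.+ y) % n ≡ (x ℕ.+ y) % n
  %-absorbˡ x y = begin
    (x % n ℕ.+ y) % n           ≡⟨ %-distribˡ-+ (x % n) y n ⟩
    (x % n % n ℕ.+ y % n) % n   ≡⟨ cong (λ z → (z ℕ.+ y % n) % n) (m%n%n≡m%n x n) ⟩
    (x % n ℕ.+ y % n) % n       ≡⟨ %-distribˡ-+ x y n ⟨
    (x ℕ.+ y) % n               ∎
    where open ≡-Reasoning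

  %-absorbʳ : ∀ x y → (x ℕ.+ y % n) % n ≡ (x ℕ.+ y) % n
  %-absorbʳ x y = begin
    (x ℕ.+ y % n) % n  ≡⟨ cong (_% n) (ℕP.+-comm x _) ⟩
    (y % n ℕ.+ x) % n  ≡⟨ %-absorbˡ y x ⟩
    (y ℕ.+ x) % n      ≡⟨ cong (_% n) (ℕP.+-comm y x) ⟩
    (x ℕ.+ y) % n      ∎
    where open ≡-Reasoning

  ⊕-assoc : ∀ a b c → (a ⊕ b) ⊕ c ≡ a ⊕ (b ⊕ c)
  ⊕-assoc a b c = modn-cong (begin
    (toℕ (a ⊕ b) ℕ.+ toℕ c) % n            ≡⟨ cong (λ z → (z ℕ.+ toℕ c) % n) (toℕ-modn _) ⟩
    ((toℕ a ℕ.+ toℕ b) % n ℕ.+ toℕ c) % n  ≡⟨ %-absorbˡ _ _ ⟩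
    (toℕ a ℕ.+ toℕ b ℕ.+ toℕ c) % n        ≡⟨ cong (_% n) (ℕP.+-assoc (toℕ a) _ _) ⟩
    (toℕ a ℕ.+ (toℕ b ℕ.+ toℕ c)) % n      ≡⟨ %-absorbʳ _ _ ⟨
    (toℕ a ℕ.+ (toℕ b ℕ.+ toℕ c) % n) % n  ≡⟨ cong (λ z → (toℕ a ℕ.+ z) % n) (toℕ-modn _) ⟨
    (toℕ a ℕ.+ toℕ (b ⊕ c)) % n            ∎)
    where open ≡-Reasoning

  ⊕-comm : ∀ a b → a ⊕ b ≡ b ⊕ a
  ⊕-comm a b = cong (modn n) (ℕP.+-comm (toℕ a) (toℕ b))

  ⊕-identityˡ : ∀ a → 0ₙ ⊕ a ≡ a
  ⊕-identityˡ a = trans (modn-cong (trans (cong (λ z → (z ℕ.+ toℕ a) % n) (toℕ-modn 0)) (%-absorbˡ 0 _)))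
                        (modn-toℕ a)

  ⊕-inverseʳ : ∀ a → a ⊕ ⊖ a ≡ 0ₙ
  ⊕-inverseʳ a = modn-cong (begin
    (toℕ a ℕ.+ toℕ (⊖ a)) % n          ≡⟨ cong (λ z → (toℕ a ℕ.+ z) % n) (toℕ-modn _) ⟩
    (toℕ a ℕ.+ (n ℕ.∸ toℕ a) % n) % n  ≡⟨ %-absorbʳ _ _ ⟩
    (toℕ a ℕ.+ (n ℕ.∸ toℕ a)) % n      ≡⟨ cong (_% n) (ℕP.m+[n∸m]≡n (ℕP.<⇒≤ (FP.toℕ<n a))) ⟩
    n % n                              ≡⟨ n%n≡0 n ⟩
    0                                  ≡⟨ m<n⇒m%n≡m (>-nonZero⁻¹ n) ⟨
    0 % n                              ∎)
    where open ≡-Reasoning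

  isAbelianGroup : IsAbelianGroup _≡_ _⊕_ 0ₙ ⊖_
  isAbelianGroup = record
    { isGroup = record
      { isMonoid = record
        { isSemigroup = record
          { isMagma = record { isEquivalence = isEquivalence ; ∙-cong = cong₂ _⊕_ }
          ; assoc = ⊕-assoc }
        ; identity = comm∧idˡ⇒id ⊕-comm ⊕-identityˡ }
      ; inverse = comm∧invʳ⇒inv ⊕-comm ⊕-inverseʳ
      ; ⁻¹-cong = cong ⊖_ }
    ; comm = ⊕-comm }

  abelianGroup : AbelianGroup _ _
  abelianGroup = record { isAbelianGroup = isAbelianGroup }

  open AbelianGroupProperties abelianGroup public using () renaming (∙-cancelˡ to ⊕-cancelˡ)

  shift : ℕ → Fin n → Fin n
  shift m a = modn n (m ℕ.+ toℕ a)

  shift-zero : ∀ a → shift 0 a ≡ a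
  shift-zero = modn-toℕ

  shift-suc : ∀ m a → shift (suc m) a ≡ shift 1 (shift m a)
  shift-suc m a = modn-cong (begin
    suc (m ℕ.+ toℕ a) % n            ≡⟨ %-absorbʳ 1 (m ℕ.+ toℕ a) ⟨
    suc ((m ℕ.+ toℕ a) % n) % n      ≡⟨ cong (λ z → suc z % n) (toℕ-modn _) ⟨
    suc (toℕ (shift m a)) % n        ∎)
    where open ≡-Reasoning

  toℕ-shift1-< : ∀ a → suc (toℕ a) ℕ.< n → toℕ (shift 1 a) ≡ suc (toℕ a)
  toℕ-shift1-< a p = trans (toℕ-modn _) (m<n⇒m%n≡m p)

  toℕ-shift1-≡ : ∀ a → suc (toℕ a) ≡ n → toℕ (shift 1 a) ≡ 0
  toℕ-shift1-≡ a p = trans (toℕ-modn _) (trans (cong (_% n) p) (n%n≡0 n))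

  -- Adding 1 moves every point one step along the circle; only the last point
  -- wraps around to 0, which turns a linear triple into a rotated one.
  shift1-between : ∀ {a b c} → a Fin.< b → b Fin.< c → Cyclicₙ (shift 1 a) (shift 1 b) (shift 1 c)
  shift1-between {a} {b} {c} a<b b<c with ℕP.m≤n⇒m<n∨m≡n (FP.toℕ<n c)
  ... | inj₁ c+1<n = inj₁ (subst₂ ℕ._<_ (sym a') (sym b') (ℕ.s<s a<b) ,
                           subst₂ ℕ._<_ (sym b') (sym (toℕ-shift1-< c c+1<n)) (ℕ.s<s b<c))
    where
    b' = toℕ-shift1-< b (ℕP.<-trans (ℕ.s<s b<c) c+1<n)
    a' = toℕ-shift1-< a (ℕP.<-trans (ℕ.s<s a<b) (ℕP.<-trans (ℕ.s<s b<c) c+1<n))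
  ... | inj₂ c+1≡n = inj₂ (inj₂ (subst₂ ℕ._<_ (sym (toℕ-shift1-≡ c c+1≡n)) (sym a') ℕ.z<s ,
                                 subst₂ ℕ._<_ (sym a') (sym b') (ℕ.s<s a<b)))
    where
    b+1<n : suc (toℕ b) ℕ.< n
    b+1<n = subst (suc (toℕ b) ℕ.<_) c+1≡n (ℕ.s<s b<c)
    a' = toℕ-shift1-< a (ℕP.<-trans (ℕ.s<s a<b) b+1<n)
    b' = toℕ-shift1-< b b+1<n

  shift1-cyclic : ∀ {a b c} → Cyclicₙ a b c → Cyclicₙ (shift 1 a) (shift 1 b) (shift 1 c)
  shift1-cyclic (inj₁ (a<b , b<c))        = shift1-between a<b b<c
  shift1-cyclic (inj₂ (inj₁ (b<c , c<a))) = cycₙ-rotate (cycₙ-rotate (shift1-between b<c c<a))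
  shift1-cyclic (inj₂ (inj₂ (c<a , a<b))) = cycₙ-rotate (shift1-between c<a a<b)

  shift-cyclic : ∀ m {a b c} → Cyclicₙ a b c → Cyclicₙ (shift m a) (shift m b) (shift m c)
  shift-cyclic zero    {a} {b} {c} h
    rewrite shift-zero a | shift-zero b | shift-zero c = h
  shift-cyclic (suc m) {a} {b} {c} h
    rewrite shift-suc m a | shift-suc m b | shift-suc m c = shift1-cyclic (shift-cyclic m h)

  ⊕-cyclic : ∀ h {a b c} → Cyclicₙ a b c → Cyclicₙ (h ⊕ a) (h ⊕ b) (h ⊕ c)
  ⊕-cyclic h = shift-cyclic (toℕ h)

ℕ-injection⇒Infinite : (M : CStr) (f : ℕ → CStr.Carrier M) →
                       (∀ {i j} → f i ≡ f j → i ≡ j) → Infinite M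
ℕ-injection⇒Infinite M f f-injective k g g-surjective
  with FP.pigeonhole (ℕP.n<1+n k) (λ i → proj₁ (g-surjective (f (toℕ i))))
... | i , j , i<j , same-preimage =
  FP.<-irrefl (FP.toℕ-injective (f-injective (begin
    f (toℕ i)                            ≡⟨ proj₂ (g-surjective (f (toℕ i))) refl ⟨
    g (proj₁ (g-surjective (f (toℕ i)))) ≡⟨ cong g same-preimage ⟩
    g (proj₁ (g-surjective (f (toℕ j)))) ≡⟨ proj₂ (g-surjective (f (toℕ j))) refl ⟩
    f (toℕ j)                            ∎))) i<j
  where open ≡-Reasoning

module LexProduct (n : ℕ) .{{_ : NonZero n}} (D : LinOrdAbGroup) where
  open OrderedGroupProperties D
  module ℤₙ = CyclicGroup n
  open ℤₙ using (_⊕_; 0ₙ; ⊖_; Cyclicₙ)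

  P : CStr
  P = TU n ×→ D

  open CStr P using (R) renaming (Carrier to Pc; _∙_ to _∙ₚ_)

  -- The middle disjunct of the order of H ×→ Λ: two points in one coset, the third elsewhere.
  Coset : Pc → Pc → Pc → Set
  Coset (ga , xa) (gb , xb) (gc , xc) = ga ≡ gb × gb ≢ gc × xa < xb

  _<ₗ_ : Pc → Pc → Set
  _<ₗ_ = ×-Lex _≡_ Fin._<_ _<_

  <ₗ-isStrictTotalOrder : IsStrictTotalOrder _≡_ _<ₗ_
  <ₗ-isStrictTotalOrder = isStrictTotalOrderᶜ record
    { isEquivalence = isEquivalence
    ; trans         = ×-transitive {_≈₁_ = _≡_} {_<₁_ = Fin._<_} {_<₂_ = _<_}
                        isEquivalence (resp₂ Fin._<_) FP.<-trans <-trans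
    ; compare       = λ p q → pointwise⇒≡ (×-compare sym FP.<-cmp compare p q)
    }
    where
    pointwise⇒≡ : ∀ {p q : Pc} → Tri (p <ₗ q) (Pointwise _≡_ _≡_ p q) (q <ₗ p) →
                                 Tri (p <ₗ q) (p ≡ q) (q <ₗ p)
    pointwise⇒≡ (tri< a ¬b ¬c) = tri< a (¬b ∘ ≡⇒≡×≡) ¬c
    pointwise⇒≡ (tri≈ ¬a b ¬c) = tri≈ ¬a (≡×≡⇒≡ b) ¬c
    pointwise⇒≡ (tri> ¬a ¬b c) = tri> ¬a (¬b ∘ ≡⇒≡×≡) c

  open CyclicClosure <ₗ-isStrictTotalOrder renaming (Cyclic to Cyclicₗ)

  R-rotate : ∀ {p q r} → R p q r → R q r p
  R-rotate (inj₁ (refl , refl , c)) = inj₁ (refl , refl , Cyc3-rotate {P = Between _<_} c)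
  R-rotate (inj₂ (inj₁ c))          = inj₂ (inj₁ (Cyc3-rotate {P = Coset} c))
  R-rotate (inj₂ (inj₂ c))          = inj₂ (inj₂ (Cyc3-rotate {P = Between Fin._<_} c))

  between⇒R : ∀ {p q r} → Between _<ₗ_ p q r → R p q r
  between⇒R (inj₁ g₁<g₂ , inj₁ g₂<g₃)                   = inj₂ (inj₂ (inj₁ (g₁<g₂ , g₂<g₃)))
  between⇒R (inj₁ g₁<g₂ , inj₂ (refl , x₂<x₃))          =
    inj₂ (inj₁ (inj₂ (inj₁ (refl , FP.<⇒≢ g₁<g₂ ∘ sym , x₂<x₃))))
  between⇒R (inj₂ (refl , x₁<x₂) , inj₁ g₂<g₃)          = inj₂ (inj₁ (inj₁ (refl , FP.<⇒≢ g₂<g₃ , x₁<x₂)))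
  between⇒R (inj₂ (refl , x₁<x₂) , inj₂ (refl , x₂<x₃)) = inj₁ (refl , refl , inj₁ (x₁<x₂ , x₂<x₃))

  cyclic⇒R : ∀ {p q r} → Cyclicₗ p q r → R p q r
  cyclic⇒R (inj₁ b)        = between⇒R b
  cyclic⇒R (inj₂ (inj₁ b)) = R-rotate (R-rotate (between⇒R b))
  cyclic⇒R (inj₂ (inj₂ b)) = R-rotate (between⇒R b)

  coset⇒cyclic : ∀ {p q r} → Coset p q r → Cyclicₗ p q r
  coset⇒cyclic {_ , _} {g₂ , _} {g₃ , _} (refl , g₂≢g₃ , x₁<x₂) with FP.<-cmp g₂ g₃
  ... | tri< g₂<g₃ _ _  = inj₁ (inj₂ (refl , x₁<x₂) , inj₁ g₂<g₃)
  ... | tri≈ _ g₂≡g₃ _  = ⊥-elim (g₂≢g₃ g₂≡g₃)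
  ... | tri> _ _ g₃<g₂  = inj₂ (inj₂ (inj₁ g₃<g₂ , inj₂ (refl , x₁<x₂)))

  R⇒cyclic : ∀ {p q r} → R p q r → Cyclicₗ p q r
  R⇒cyclic (inj₁ (refl , refl , c)) =
    Cyc3-map {P = Between _<_} {Q = Between _<ₗ_} (_ ,_) (λ (a , b) → inj₂ (refl , a) , inj₂ (refl , b)) c
  R⇒cyclic (inj₂ (inj₁ (inj₁ c)))        = coset⇒cyclic c
  R⇒cyclic (inj₂ (inj₁ (inj₂ (inj₁ c)))) = cyc-rotate (cyc-rotate (coset⇒cyclic c))
  R⇒cyclic (inj₂ (inj₁ (inj₂ (inj₂ c)))) = cyc-rotate (coset⇒cyclic c)
  R⇒cyclic (inj₂ (inj₂ (inj₁ (a , b))))          = inj₁ (inj₁ a , inj₁ b)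
  R⇒cyclic (inj₂ (inj₂ (inj₂ (inj₁ (a , b)))))   = inj₂ (inj₁ (inj₁ a , inj₁ b))
  R⇒cyclic (inj₂ (inj₂ (inj₂ (inj₂ (a , b)))))   = inj₂ (inj₂ (inj₁ a , inj₁ b))

  R-compatˡ : ∀ h a b c → R a b c → R (h ∙ₚ a) (h ∙ₚ b) (h ∙ₚ c)
  R-compatˡ (k , y) _ _ _ (inj₁ (refl , refl , c)) =
    inj₁ (refl , refl , Cyc3-map {P = Between _<_} {Q = Between _<_} (y +_)
                          (λ (a , b) → +-monoˡ-< y a , +-monoˡ-< y b) c)
  R-compatˡ (k , y) _ _ _ (inj₂ (inj₁ c)) =
    inj₂ (inj₁ (Cyc3-map {P = Coset} {Q = Coset} ((k , y) ∙ₚ_)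
      (λ (e , ne , lt) → cong (k ⊕_) e , ne ∘ ℤₙ.⊕-cancelˡ k _ _ , +-monoˡ-< y lt) c))
  R-compatˡ (k , y) _ _ _ (inj₂ (inj₂ c)) = inj₂ (inj₂ (ℤₙ.⊕-cyclic k c))

  ∙ₚ-comm : ∀ a h → a ∙ₚ h ≡ h ∙ₚ a
  ∙ₚ-comm (g , x) (k , y) = cong₂ _,_ (ℤₙ.⊕-comm g k) (comm x y)

  R-compatʳ : ∀ h a b c → R a b c → R (a ∙ₚ h) (b ∙ₚ h) (c ∙ₚ h)
  R-compatʳ h a b c r = R-resp (∙ₚ-comm h a) (∙ₚ-comm h b) (∙ₚ-comm h c) (R-compatˡ h a b c r)
    where
    R-resp : ∀ {a b c a' b' c'} → a ≡ a' → b ≡ b' → c ≡ c' → R a b c → R a' b' c'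
    R-resp refl refl refl r = r

  isGroup : IsGroup _≡_ _∙ₚ_ (0ₙ , 0#) (λ (g , x) → ⊖ g , - x)
  isGroup = record
    { isMonoid = record
      { isSemigroup = record
        { isMagma = record { isEquivalence = isEquivalence ; ∙-cong = cong₂ _∙ₚ_ }
        ; assoc = λ (g , x) (h , y) (k , z) → cong₂ _,_ (ℤₙ.⊕-assoc g h k) (assoc x y z) }
      ; identity = (λ (g , x) → cong₂ _,_ (G.identityˡ g) (identityˡ x))
                 , (λ (g , x) → cong₂ _,_ (G.identityʳ g) (identityʳ x)) }
    ; inverse = (λ (g , x) → cong₂ _,_ (G.inverseˡ g) (inverseˡ x))
              , (λ (g , x) → cong₂ _,_ (G.inverseʳ g) (inverseʳ x))
    ; ⁻¹-cong = cong (λ (g , x) → ⊖ g , - x) }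
    where module G = IsAbelianGroup ℤₙ.isAbelianGroup

  isCOGroup : IsCOGroup P
  isCOGroup = record
    { isGroup = isGroup
    ; strict  = strict ∘ R⇒cyclic
    ; cyclic  = R-rotate
    ; irrefl  = λ g x → cyc-irrefl g x ∘ R⇒cyclic
    ; asym    = λ g x y r r' → cyc-asym g x y (R⇒cyclic r) (R⇒cyclic r')
    ; trans   = λ g x y z r r' → cyclic⇒R (cyc-trans g x y z (R⇒cyclic r) (R⇒cyclic r'))
    ; total   = λ g x y x≢g y≢g x≢y → Sum.map cyclic⇒R cyclic⇒R (cyc-total g x y x≢g y≢g x≢y)
    ; compatˡ = R-compatˡ
    ; compatʳ = R-compatʳ
    }

  infinite : Nontrivial → Infinite P
  infinite nontrivial = let (t , 0<t) = nontrivial⇒positive nontrivial in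
    ℕ-injection⇒Infinite P (λ m → 0ₙ , m · t) (·-cancelˡ-≡ 0<t ∘ cong proj₂)

module Definability (n : ℕ) .{{_ : NonZero n}} (D : LinOrdAbGroup)
                    (nontrivial : LinOrdAbGroup.Nontrivial D) (divisible : LinOrdAbGroup.Divisible D) where
  open QuantifierElimination D nontrivial divisible
  open LexProduct n D using (P; Coset; _<ₗ_; <ₗ-isStrictTotalOrder; R⇒cyclic)
  open CyclicGroup n using (_⊕_; 0ₙ; ⊖_; cyclicₙ?)
  open CStr P using (R) renaming (Carrier to Pc; _∙_ to _∙ₚ_; _⁻¹ to _⁻¹ₚ)
  open IsStrictTotalOrder <ₗ-isStrictTotalOrder using () renaming (asym to <ₗ-asym)
  open EquationalReasoning {k = equivalence}

  -- A term of the product splits into its component in T(U)ₙ, which depends only on the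
  -- components of the variables in T(U)ₙ, and a linear form in the components in D.
  finPart : ∀ {k} → Vector (Fin n) k → Term P k → Fin n
  finPart γ (var i)  = γ i
  finPart γ (par c)  = proj₁ c
  finPart γ eₜ       = 0ₙ
  finPart γ (s ·ₜ t) = finPart γ s ⊕ finPart γ t
  finPart γ (invₜ t) = ⊖ finPart γ t

  formPart : ∀ {k} → Term P k → Form k
  formPart (var i)  = varF i
  formPart (par c)  = constF (proj₂ c)
  formPart eₜ       = constF 0#
  formPart (s ·ₜ t) = formPart s +F formPart t
  formPart (invₜ t) = -F formPart t

  Split : ∀ {k} → Vector Pc k → Vector (Fin n) k → Env k → Set
  Split ρ γ δ = ∀ i → ρ i ≡ (γ i , δ i)

  split-extend : ∀ {k} {ρ : Vector Pc k} {γ δ} → Split ρ γ δ →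
                 ∀ g d → Split (extend P (g , d) ρ) (g ∷ᵥ γ) (d ∷ᵥ δ)
  split-extend sp g d Fin.zero    = refl
  split-extend sp g d (Fin.suc i) = sp i

  evalT-split : ∀ {k} {ρ : Vector Pc k} {γ δ} → Split ρ γ δ →
                ∀ t → evalT P ρ t ≡ (finPart γ t , eval (formPart t) δ)
  evalT-split {δ = δ} sp (var i)  = trans (sp i) (cong (_ ,_) (sym (eval-var i δ)))
  evalT-split {δ = δ} sp (par c)  = cong (proj₁ c ,_) (sym (eval-const (proj₂ c) δ))
  evalT-split {δ = δ} sp eₜ       = cong (0ₙ ,_) (sym (eval-const 0# δ))
  evalT-split {δ = δ} sp (s ·ₜ t) = trans (cong₂ _∙ₚ_ (evalT-split sp s) (evalT-split sp t))
                                          (cong (_ ,_) (sym (eval-+ (formPart s) (formPart t) δ)))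
  evalT-split {δ = δ} sp (invₜ t) = trans (cong _⁻¹ₚ (evalT-split sp t))
                                          (cong (_ ,_) (sym (eval-neg (formPart t) δ)))

  eqD : ∀ {k} → Form k → Form k → DNF k
  eqD f g = (eq0 (f -F g) ∷ []) ∷ []

  sat-eqD : ∀ {k} {δ : Env k} f g → SatD δ (eqD f g) ⇔ (eval f δ ≡ eval g δ)
  sat-eqD {δ = δ} f g = ⇔.trans (sat-single _)
    (mk⇔ (x∙y⁻¹≈ε⇒x≈y _ _ ∘ trans (sym (eval-- f g δ))) (trans (eval-- f g δ) ∘ x≈y⇒x∙y⁻¹≈ε))

  lessD : ∀ {k} → Form k → Form k → DNF k
  lessD f g = (pos (g -F f) ∷ []) ∷ []

  sat-lessD : ∀ {k} {δ : Env k} f g → SatD δ (lessD f g) ⇔ (eval f δ < eval g δ)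
  sat-lessD {δ = δ} f g = ⇔.trans (sat-single _)
    (mk⇔ (0<-⇒< ∘ subst (0# <_) (eval-- g f δ)) (subst (0# <_) (sym (eval-- g f δ)) ∘ <⇒0<-))

  betweenD : ∀ {k} → Form k → Form k → Form k → DNF k
  betweenD f g h = lessD f g ∧D lessD g h

  sat-betweenD : ∀ {k} {δ : Env k} f g h →
                 SatD δ (betweenD f g h) ⇔ Between _<_ (eval f δ) (eval g δ) (eval h δ)
  sat-betweenD f g h = ⇔.trans (sat-∧D (lessD f g) (lessD g h)) (sat-lessD f g ×-⇔ sat-lessD g h)

  cyclicD : ∀ {k} → Form k → Form k → Form k → DNF k
  cyclicD f g h = betweenD f g h ++ (betweenD g h f ++ betweenD h f g)

  sat-cyclicD : ∀ {k} {δ : Env k} f g h →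
                SatD δ (cyclicD f g h) ⇔ Cyc3 (Between _<_) (eval f δ) (eval g δ) (eval h δ)
  sat-cyclicD f g h =
    ⇔.trans (sat-++ (betweenD f g h) _) (sat-betweenD f g h ⊎-⇔
    ⇔.trans (sat-++ (betweenD g h f) _) (sat-betweenD g h f ⊎-⇔ sat-betweenD h f g))

  cosetD : ∀ {k} → Fin n → Fin n → Fin n → Form k → Form k → DNF k
  cosetD ga gb gc fa fb = guard (ga FP.≟ gb) ∧D (guard (¬? (gb FP.≟ gc)) ∧D lessD fa fb)

  sat-cosetD : ∀ {k} {δ : Env k} ga gb gc fa fb x →
               SatD δ (cosetD ga gb gc fa fb) ⇔ Coset (ga , eval fa δ) (gb , eval fb δ) (gc , x)
  sat-cosetD ga gb gc fa fb x =
    ⇔.trans (sat-∧D (guard (ga FP.≟ gb)) _) (sat-guard _ ×-⇔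
    ⇔.trans (sat-∧D (guard (¬? (gb FP.≟ gc))) _) (sat-guard _ ×-⇔ sat-lessD fa fb))

  RD : ∀ {k} → Fin n → Fin n → Fin n → Form k → Form k → Form k → DNF k
  RD g₁ g₂ g₃ f₁ f₂ f₃ =
    (guard (g₁ FP.≟ g₂) ∧D (guard (g₂ FP.≟ g₃) ∧D cyclicD f₁ f₂ f₃))
    ++ ((cosetD g₁ g₂ g₃ f₁ f₂ ++ (cosetD g₂ g₃ g₁ f₂ f₃ ++ cosetD g₃ g₁ g₂ f₃ f₁))
        ++ guard (cyclicₙ? g₁ g₂ g₃))

  sat-RD : ∀ {k} {δ : Env k} g₁ g₂ g₃ f₁ f₂ f₃ →
           SatD δ (RD g₁ g₂ g₃ f₁ f₂ f₃) ⇔ R (g₁ , eval f₁ δ) (g₂ , eval f₂ δ) (g₃ , eval f₃ δ)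
  sat-RD {δ = δ} g₁ g₂ g₃ f₁ f₂ f₃ =
    ⇔.trans (sat-++ sameCoset _)
      (⇔.trans (sat-∧D (guard (g₁ FP.≟ g₂)) _)
        (sat-guard _ ×-⇔ ⇔.trans (sat-∧D (guard (g₂ FP.≟ g₃)) _) (sat-guard _ ×-⇔ sat-cyclicD f₁ f₂ f₃))
      ⊎-⇔ ⇔.trans (sat-++ cosets _)
        (⇔.trans (sat-++ (cosetD g₁ g₂ g₃ f₁ f₂) _) (sat-cosetD g₁ g₂ g₃ f₁ f₂ (eval f₃ δ) ⊎-⇔
         ⇔.trans (sat-++ (cosetD g₂ g₃ g₁ f₂ f₃) _) (sat-cosetD g₂ g₃ g₁ f₂ f₃ (eval f₁ δ) ⊎-⇔
                                                      sat-cosetD g₃ g₁ g₂ f₃ f₁ (eval f₂ δ)))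
         ⊎-⇔ sat-guard (cyclicₙ? g₁ g₂ g₃)))
    where
    sameCoset = guard (g₁ FP.≟ g₂) ∧D (guard (g₂ FP.≟ g₃) ∧D cyclicD f₁ f₂ f₃)
    cosets = cosetD g₁ g₂ g₃ f₁ f₂ ++ (cosetD g₂ g₃ g₁ f₂ f₃ ++ cosetD g₃ g₁ g₂ f₃ f₁)

  ⋁ : ∀ {k} → (Fin n → DNF k) → DNF k
  ⋁ F = concatMap F (allFin n)

  sat-⋁ : ∀ {k} {δ : Env k} F → SatD δ (⋁ F) ⇔ ∃ λ g → SatD δ (F g)
  sat-⋁ F = mk⇔ (Any.satisfied ∘ Anyₚ.concatMap⁻ F {xs = allFin n})
                (λ (g , s) → Anyₚ.concatMap⁺ F (lose (∈-allFin g) s))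

  translate : ∀ {k} → Formula P k → Vector (Fin n) k → DNF k
  translate (s ≐ t)    γ = guard (finPart γ s FP.≟ finPart γ t) ∧D eqD (formPart s) (formPart t)
  translate (Rₜ s t u) γ = RD (finPart γ s) (finPart γ t) (finPart γ u) (formPart s) (formPart t) (formPart u)
  translate ⊥ₜ         γ = []
  translate (¬ₜ φ)     γ = ¬D (translate φ γ)
  translate (φ ∧ₜ ψ)   γ = translate φ γ ∧D translate ψ γ
  translate (φ ∨ₜ ψ)   γ = translate φ γ ++ translate ψ γ
  translate (φ ⇒ₜ ψ)   γ = ¬D (translate φ γ) ++ translate ψ γ
  translate (∃ₜ φ)     γ = ⋁ λ g → ∃D (translate φ (g ∷ᵥ γ))
  translate (∀ₜ φ)     γ = ¬D (⋁ λ g → ∃D (¬D (translate φ (g ∷ᵥ γ))))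

  ∃-split : ∀ {k} {δ : Env k} (A : Pc → Set) (F : Fin n → DNF (suc k)) →
            (∀ g d → A (g , d) ⇔ SatD (d ∷ᵥ δ) (F g)) → (∃ A) ⇔ SatD δ (⋁ λ g → ∃D (F g))
  ∃-split {δ = δ} A F A⇔F = mk⇔
    (λ ((g , d) , a) → Equivalence.from (sat-⋁ _)
      (g , Equivalence.to (∃D-correct δ (F g)) (d , Equivalence.to (A⇔F g d) a)))
    (λ s → let (g , s′) = Equivalence.to (sat-⋁ _) s
               (d , s″) = Equivalence.from (∃D-correct δ (F g)) s′
           in (g , d) , Equivalence.from (A⇔F g d) s″)

  ∀⇔¬∃¬ : {X : Set} (A : X → Set) → (∀ x → Dec (A x)) → (∀ x → A x) ⇔ (¬ ∃ λ x → ¬ A x)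
  ∀⇔¬∃¬ A A? = mk⇔ (λ all (x , ¬a) → ¬a (all x)) (λ ¬∃ x → decidable-stable (A? x) (λ ¬a → ¬∃ (x , ¬a)))

  ≡-resp-⇔ : ∀ {A : Set} {a a' b b' : A} → a ≡ a' → b ≡ b' → (a ≡ b) ⇔ (a' ≡ b')
  ≡-resp-⇔ refl refl = ⇔.refl

  R-resp-⇔ : ∀ {a a' b b' c c'} → a ≡ a' → b ≡ b' → c ≡ c' → R a b c ⇔ R a' b' c'
  R-resp-⇔ refl refl refl = ⇔.refl

  ,-≡-⇔ : ∀ {g h : Fin n} {x y : Dc} → ((g , x) ≡ (h , y)) ⇔ (g ≡ h × x ≡ y)
  ,-≡-⇔ = mk⇔ (λ e → cong proj₁ e , cong proj₂ e) (uncurry (cong₂ _,_))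

  translate-correct : ∀ {k} (φ : Formula P k) {ρ γ δ} → Split ρ γ δ →
                      Sat P ρ φ ⇔ SatD δ (translate φ γ)
  translate-correct (s ≐ t) {ρ} {γ} {δ} sp = begin
    evalT P ρ s ≡ evalT P ρ t
      ∼⟨ ≡-resp-⇔ (evalT-split sp s) (evalT-split sp t) ⟩
    (finPart γ s , eval (formPart s) δ) ≡ (finPart γ t , eval (formPart t) δ)
      ∼⟨ ,-≡-⇔ ⟩
    (finPart γ s ≡ finPart γ t × eval (formPart s) δ ≡ eval (formPart t) δ)
      ∼⟨ ⇔.sym (⇔.trans (sat-∧D (guard (finPart γ s FP.≟ finPart γ t)) _)
                        (sat-guard _ ×-⇔ sat-eqD (formPart s) (formPart t))) ⟩
    SatD δ (translate (s ≐ t) γ) ∎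
  translate-correct (Rₜ s t u) {γ = γ} sp = ⇔.trans
    (R-resp-⇔ (evalT-split sp s) (evalT-split sp t) (evalT-split sp u))
    (⇔.sym (sat-RD (finPart γ s) (finPart γ t) (finPart γ u) (formPart s) (formPart t) (formPart u)))
  translate-correct ⊥ₜ sp = mk⇔ (λ ()) (λ ())
  translate-correct (¬ₜ φ) {γ = γ} sp =
    ⇔.trans (¬-cong-⇔ (translate-correct φ sp)) (⇔.sym (sat-¬D (translate φ γ)))
  translate-correct (φ ∧ₜ ψ) {γ = γ} sp =
    ⇔.trans (translate-correct φ sp ×-⇔ translate-correct ψ sp) (⇔.sym (sat-∧D (translate φ γ) _))
  translate-correct (φ ∨ₜ ψ) {γ = γ} sp =
    ⇔.trans (translate-correct φ sp ⊎-⇔ translate-correct ψ sp) (⇔.sym (sat-++ (translate φ γ) _))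
  translate-correct (φ ⇒ₜ ψ) {γ = γ} sp =
    ⇔.trans (→-cong-⇔ (translate-correct φ sp) (translate-correct ψ sp)) (⇔.sym (sat-⇒D (translate φ γ) _))
  translate-correct (∃ₜ φ) {ρ} {γ} sp =
    ∃-split (λ x → Sat P (extend P x ρ) φ) (λ g → translate φ (g ∷ᵥ γ))
            (λ g d → translate-correct φ (split-extend sp g d))
  translate-correct (∀ₜ φ) {ρ} {γ} {δ} sp = begin
    (∀ x → Sat P (extend P x ρ) φ)
      ∼⟨ ∀⇔¬∃¬ _ (λ (g , d) → Dec.map (⇔.sym (IH g d)) (SatD? _ _)) ⟩
    ¬ (∃ λ x → ¬ Sat P (extend P x ρ) φ)
      ∼⟨ ¬-cong-⇔ (∃-split _ _ (λ g d → ⇔.trans (¬-cong-⇔ (IH g d)) (⇔.sym (sat-¬D _)))) ⟩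
    ¬ SatD δ (⋁ λ g → ∃D (¬D (translate φ (g ∷ᵥ γ))))
      ∼⟨ ⇔.sym (sat-¬D _) ⟩
    SatD δ (translate (∀ₜ φ) γ) ∎
    where
    IH : ∀ g d → Sat P (extend P (g , d) ρ) φ ⇔ SatD (d ∷ᵥ δ) (translate φ (g ∷ᵥ γ))
    IH g d = translate-correct φ (split-extend sp g d)

  coset-interval : ∀ {g g' a b c} → R (g , a) (g' , c) (g , b) → a < b → g' ≡ g × a < c × c < b
  coset-interval r a<b with R⇒cyclic r
  ... | inj₁ (inj₂ (refl , a<c) , inj₂ (refl , c<b)) = refl , a<c , c<b
  ... | inj₁ (inj₁ g<g' , inj₁ g'<g)                 = ⊥-elim (FP.<-asym g<g' g'<g)
  ... | inj₁ (inj₁ g<g' , inj₂ (refl , _))           = ⊥-elim (FP.<-irrefl refl g<g')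
  ... | inj₁ (inj₂ (refl , _) , inj₁ g<g)            = ⊥-elim (FP.<-irrefl refl g<g)
  ... | inj₂ (inj₁ (_ , b<ₗa))                        = ⊥-elim (<ₗ-asym (inj₂ (refl , a<b)) b<ₗa)
  ... | inj₂ (inj₂ (b<ₗa , _))                        = ⊥-elim (<ₗ-asym (inj₂ (refl , a<b)) b<ₗa)

  Block : Fin n → Clause 1 → Pc → Set
  Block g cl (h , d) = h ≡ g × SatC (d ∷ᵥ []ᵥ) cl

  Block-cconvex : ∀ g cl → IsCConvex P (Block g cl)
  Block-cconvex g cl = inj₂ convex
    where
    inside : ∀ {a b} → a < b → SatC (a ∷ᵥ []ᵥ) cl → SatC (b ∷ᵥ []ᵥ) cl →
             ∀ h → I P (g , a) (g , b) h → Block g cl h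
    inside a<b sa sb (g' , c) r with coset-interval r a<b
    ... | g'≡g , a<c , c<b = g'≡g , convex-clause cl a<c c<b sa sb

    convex : ∀ p q → Block g cl p → Block g cl q → p ≢ q →
             (∀ h → I P p q h → Block g cl h) ⊎ (∀ h → I P q p h → Block g cl h)
    convex (_ , a) (_ , b) (refl , sa) (refl , sb) p≢q with compare a b
    ... | tri< a<b _ _  = inj₁ (inside a<b sa sb)
    ... | tri≈ _ refl _ = ⊥-elim (p≢q refl)
    ... | tri> _ _ b<a  = inj₂ (inside b<a sb sa)

  blocks : Formula P 1 → List (Pc → Set)
  blocks φ = concatMap (λ g → map (Block g) (translate φ (λ _ → g))) (allFin n)

  blocks-cconvex : ∀ φ → All (IsCConvex P) (blocks φ)
  blocks-cconvex φ = Allₚ.concat⁺ (Allₚ.map⁺ (All.universal blockwise (allFin n)))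
    where
    blockwise : ∀ g → All (IsCConvex P) (map (Block g) (translate φ (λ _ → g)))
    blockwise g = Allₚ.map⁺ (All.universal (Block-cconvex g) (translate φ (λ _ → g)))

  in-blocks : ∀ φ x → Defined P φ x ⇔ Any (λ J → J x) (blocks φ)
  in-blocks φ x@(g , d) = ⇔.trans (translate-correct φ split) (mk⇔ into outof)
    where
    split : Split (λ _ → x) (λ _ → g) (d ∷ᵥ []ᵥ)
    split Fin.zero = refl

    into : SatD (d ∷ᵥ []ᵥ) (translate φ (λ _ → g)) → Any (λ J → J x) (blocks φ)
    into s = Anyₚ.concatMap⁺ (λ g → map (Block g) (translate φ (λ _ → g)))
               (lose (∈-allFin g) (Anyₚ.map⁺ (Any.map (refl ,_) s)))

    outof : Any (λ J → J x) (blocks φ) → SatD (d ∷ᵥ []ᵥ) (translate φ (λ _ → g))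
    outof a with Any.satisfied (Anyₚ.concatMap⁻ _ {xs = allFin n} a)
    ... | g' , b with Anyₚ.map⁻ b
    ... | inside with proj₁ (proj₂ (Any.satisfied inside))
    ... | refl = Any.map proj₂ inside

  definable : DefinableFiniteCConvex P
  definable φ = blocks φ , blocks-cconvex φ , in-blocks φ


proposition5p2 : (n : ℕ) .{{_ : NonZero n}} (D : LinOrdAbGroup) →
    LinOrdAbGroup.Nontrivial D → LinOrdAbGroup.Divisible D →
    WeaklyCyclicallyMinimal (TU n ×→ D)
proposition5p2 n D nontrivial divisible = isCOGroup , infinite nontrivial , definable
  where
  open LexProduct n D
  open Definability n D nontrivial divisible
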